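{- Let $n\ge 2$ and let $\tau$ be a uniformly random permutation of $\{1,\dots,n\}$ (viewed as a bijection $\tau:\{1,\dots,n\}\to\{1,\dots,n\}$). Let $G_n$ be the graph on $\{1,\dots,n\}$ obtained by inserting vertices in increasing order of $\tau$, each newly inserted vertex $x$ being joined by an undirected edge to the largest $y<x$ with $\tau(y)<\tau(x)$ (if any) and to the smallest $y>x$ with $\tau(y)<\tau(x)$ (if any). Let $S_n$ be the number of steps of the greedy walk that starts at $1$ and, at each vertex $x\ne n$, moves to the neighbour $y$ of $x$ minimizing $|y-n|$, stopping at $n$. Let $L_n$, $R_n$ be the numbers of left-to-right minima and right-to-left minima of $\tau$. Then, with $H_n=\sum_{i=1}^n 1/i$ and $\gamma$ Euler's constant, \[ \mathbb{E}[S_n]=2H_n-2=2\log n+2\gamma-2+o(1), \] \[ \mathrm{Var}(S_n)=2\Bigl(H_n-\sum_{i=1}^n\frac1{i^2}\Bigr)+2\,\mathrm{Cov}(L_n,R_n)=2\log n+O(1), \] as $n\to\infty$.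
   Context: $\log$ denotes the natural logarithm. A position $i$ is a left-to-right minimum of $\tau$ if $\tau(i)<\tau(j)$ for all $j<i$, and a right-to-left minimum if $\tau(i)<\tau(j)$ for all $j>i$. -}

module Defs where

open import Data.Bool using (Bool; true; false; _∧_; _∨_; not; if_then_else_)
open import Data.Nat as ℕ using (ℕ; zero; suc; _<ᵇ_; _≡ᵇ_; ∣_-_∣; _∸_)
open import Data.List using (List; []; _∷_; length; map; concatMap; upTo; filter; foldr)
open import Data.Bool.ListAction using (all)
open import Data.Integer using (+_)
open import Data.Rational using (ℚ; _/_; _+_; _*_; _-_)
import Data.Rational as ℚ

-- A permutation τ of {0,…,n-1} is represented by the list [τ(0), …, τ(n-1)].
-- (Positions/values 0,…,n-1 play the role of the paper's 1,…,n.)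

insertions : ℕ → List ℕ → List (List ℕ)
insertions v []       = (v ∷ []) ∷ []
insertions v (x ∷ xs) = (v ∷ x ∷ xs) ∷ map (x ∷_) (insertions v xs)

perms : ℕ → List (List ℕ)
perms zero    = [] ∷ []
perms (suc n) = concatMap (insertions n) (perms n)

-- τ(i) (default 0 out of range; never used out of range)
at : List ℕ → ℕ → ℕ
at []       _       = 0
at (x ∷ xs) zero    = x
at (x ∷ xs) (suc i) = at xs i

between : ℕ → ℕ → List ℕ
between a b = map (λ k → suc a ℕ.+ k) (upTo (b ∸ suc a))

noneBelow : List ℕ → ℕ → List ℕ → Bool
noneBelow τ v zs = all (λ z → not (at τ z <ᵇ v)) zs

-- link τ x y : when x is inserted (in increasing order of τ), it is joined to y,
-- i.e. τ(y) < τ(x) and y is the largest y<x, resp. smallest y>x, with τ(y)<τ(x).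
link : List ℕ → ℕ → ℕ → Bool
link τ x y =
  (at τ y <ᵇ at τ x) ∧
  (((y <ᵇ x) ∧ noneBelow τ (at τ x) (between y x)) ∨
   ((x <ᵇ y) ∧ noneBelow τ (at τ x) (between x y)))

adj : List ℕ → ℕ → ℕ → Bool
adj τ x y = link τ x y ∨ link τ y x

greedyNext : List ℕ → ℕ → ℕ → ℕ
greedyNext τ t x = foldr step x (upTo (length τ))
  where
  step : ℕ → ℕ → ℕ
  step y best = if adj τ x y ∧ ((best ≡ᵇ x) ∨ (∣ y - t ∣ <ᵇ ∣ best - t ∣)) then y else best

walk : List ℕ → ℕ → ℕ → ℕ → ℕ
walk τ t zero    x = 0
walk τ t (suc f) x = if x ≡ᵇ t then 0 else suc (walk τ t f (greedyNext τ t x))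

-- S_n(τ): steps of the greedy walk from vertex 1 (here 0) to vertex n (here n-1).
-- Fuel n suffices: x and x+1 are always adjacent, so each step strictly increases x.
S : List ℕ → ℕ
S τ = walk τ (length τ ∸ 1) (length τ) 0

L : List ℕ → ℕ
L τ = length (filter (λ i → Data.Bool._≟_ (all (λ j → at τ i <ᵇ at τ j) (upTo i)) true) (upTo (length τ)))
  where import Data.Bool

R : List ℕ → ℕ
R τ = length (filter (λ i → Data.Bool._≟_ (noneBelow τ (at τ i) (between i (length τ))) true) (upTo (length τ)))
  where import Data.Bool

ℚsum : List ℚ → ℚ
ℚsum = foldr _+_ (ℚ.0ℚ)

mean : List ℚ → ℚ
mean []       = ℚ.0ℚ
mean (x ∷ xs) = ℚsum (x ∷ xs) * ((+ 1) / suc (length xs))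

fromℕ : ℕ → ℚ
fromℕ k = (+ k) / 1

E : ℕ → (List ℕ → ℚ) → ℚ
E n f = mean (map f (perms n))

Var : ℕ → (List ℕ → ℚ) → ℚ
Var n f = E n (λ τ → (f τ - E n f) * (f τ - E n f))

Cov : ℕ → (List ℕ → ℚ) → (List ℕ → ℚ) → ℚ
Cov n f g = E n (λ τ → (f τ - E n f) * (g τ - E n g))

H : ℕ → ℚ
H zero    = ℚ.0ℚ
H (suc n) = H n + ((+ 1) / suc n)

H2 : ℕ → ℚ
H2 zero    = ℚ.0ℚ
H2 (suc n) = H2 n + ((+ 1) / (suc n ℕ.* suc n))

module Submission where

-- The greedy walk from the first to the last position runs through the left-to-right minima of τ
-- up to the position of the global minimum and then through the right-to-left minima, so
-- S = L + R - 2 for every permutation. Every permutation of size n+1 arises exactly once by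
-- inserting the maximal value n into a permutation of size n at one of n+1 positions; this adds a
-- left-to-right minimum exactly at the first position, a right-to-left minimum exactly at the last
-- one, and changes nothing else. Averaging over the positions with u = 1/(n+1), E L and E R grow by
-- u, Var L and Var R by u - u², and Cov(L,R) by -u² (for n ≥ 1). Hence E L = E R = H_n,
-- Var L = Var R = H_n - H⁽²⁾_n and Cov(L,R) = 1 - H⁽²⁾_n, so Var S - 2H_n = 2 - 4H⁽²⁾_n, which is
-- bounded because H⁽²⁾_n ≤ 2.

open import Defs
open import Data.Nat using (ℕ)
import Data.Nat
open import Data.Product using (_×_; ∃)
open import Relation.Binary.PropositionalEquality using (_≡_)

module Combinatorics where

  open import Relation.Binary.PropositionalEquality
  open import Data.Bool using (Bool; true; false; _∧_; _∨_; not; if_then_else_)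
  import Data.Bool as Bool
  open import Data.Bool.Properties using (T-≡; not-¬; ¬-not; not-injective; ∨-zeroʳ; ∧-zeroʳ; ∧-identityʳ; ∧-assoc)
  open import Data.Bool.ListAction using (all)
  open import Data.Empty using (⊥-elim)
  open import Data.List using (List; []; _∷_; _∷ʳ_; _++_; length; map; filter; foldr; upTo; applyUpTo; concatMap)
  open import Data.List.Properties
    using (length-upTo; upTo-∷ʳ; map-upTo; map-applyUpTo; map-cong; map-∘; foldr-++; ++-assoc; ++-cancelˡ; ∷-injectiveʳ)
  open import Data.List.Membership.Propositional using (_∈_)
  open import Data.List.Membership.Propositional.Properties using (∈-map⁺; ∈-map⁻; ∈-upTo⁺; ∈-upTo⁻; ∈-concat⁻′)
  open import Data.List.Relation.Binary.Permutation.Propositional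
    using (_↭_; ↭-refl; ↭-sym; ↭-trans; ↭-prep; ↭-swap; ↭⇒↭ₛ; module PermutationReasoning)
  open import Data.List.Relation.Binary.Permutation.Propositional.Properties using (↭-length; ∈-resp-↭; ∷↭∷ʳ)
  open import Data.List.Relation.Binary.Permutation.Setoid.Properties (setoid ℕ) using (Unique-resp-↭)
  open import Data.List.Relation.Unary.Unique.Propositional using (Unique)
  open import Data.List.Relation.Unary.Unique.Propositional.Properties using (upTo⁺)
  open import Data.List.Relation.Unary.Any using (here; there)
  open import Data.List.Relation.Unary.All as All using (All; _∷_)
  open import Data.List.Relation.Unary.AllPairs using (_∷_)
  open import Data.List.Extrema.Nat using (argmin; argmin-all; f[argmin]≤f[xs])
  open import Data.Nat
  open import Data.Nat.Properties
  open import Data.Nat.Solver using (module +-*-Solver)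
  open +-*-Solver using (solve; _:+_; _:*_; _:=_; con)
  open import Algebra.Properties.CommutativeSemigroup +-commutativeSemigroup using (x∙yz≈y∙xz; interchange)
  open import Data.Product using (_,_; proj₁; proj₂; uncurry)
  open import Data.Sum using (_⊎_; inj₁; inj₂; [_,_]′)
  open import Function using (_∘_; id; Equivalence)
  open import Relation.Nullary using (yes; no)
  open import Relation.Binary.Definitions using (tri<; tri≈; tri>)

  private variable
    A : Set
    i j k m n v x y : ℕ
    xs : List A

  𝟙 : Bool → ℕ
  𝟙 false = 0
  𝟙 true  = 1

  <ᵇ-true : m < n → (m <ᵇ n) ≡ true
  <ᵇ-true m<n = Equivalence.to T-≡ (<⇒<ᵇ m<n)

  <ᵇ-true⁻ : (m <ᵇ n) ≡ true → m < n
  <ᵇ-true⁻ {m} {n} e = <ᵇ⇒< m n (Equivalence.from T-≡ e)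

  <ᵇ-false : m ≮ n → (m <ᵇ n) ≡ false
  <ᵇ-false m≮n = ¬-not (m≮n ∘ <ᵇ-true⁻)

  <ᵇ-false⁻ : (m <ᵇ n) ≡ false → m ≮ n
  <ᵇ-false⁻ e m<n = not-¬ e (<ᵇ-true m<n)

  ≡ᵇ-refl : ∀ n → (n ≡ᵇ n) ≡ true
  ≡ᵇ-refl n = Equivalence.to T-≡ (≡⇒≡ᵇ n n refl)

  ≡ᵇ-false : m ≢ n → (m ≡ᵇ n) ≡ false
  ≡ᵇ-false {m} {n} m≢n = ¬-not (m≢n ∘ ≡ᵇ⇒≡ m n ∘ Equivalence.from T-≡)

  ∧-true⁻ : ∀ {a b} → a ∧ b ≡ true → a ≡ true × b ≡ true
  ∧-true⁻ {true} {true} _ = refl , refl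

  all-true⁻ : ∀ {p : A → Bool} {a} → all p xs ≡ true → a ∈ xs → p a ≡ true
  all-true⁻ {xs = b ∷ _} {p} e (here refl) = proj₁ (∧-true⁻ {p b} e)
  all-true⁻ {xs = b ∷ _} {p} e (there a∈) = all-true⁻ (proj₂ (∧-true⁻ {p b} e)) a∈

  all-true⁺ : ∀ {p : A → Bool} xs → (∀ {a} → a ∈ xs → p a ≡ true) → all p xs ≡ true
  all-true⁺ []       _ = refl
  all-true⁺ (a ∷ xs) h rewrite h (here refl) = all-true⁺ xs (h ∘ there)

  all-false⁺ : ∀ {p : A → Bool} {a} → a ∈ xs → p a ≡ false → all p xs ≡ false
  all-false⁺ a∈ pa = ¬-not (λ e → not-¬ pa (all-true⁻ e a∈))

  all-map : ∀ (p : ℕ → Bool) (f : A → ℕ) xs → all p (map f xs) ≡ all (p ∘ f) xs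
  all-map p f []       = refl
  all-map p f (a ∷ xs) = cong (p (f a) ∧_) (all-map p f xs)

  count : (A → Bool) → List A → ℕ
  count p xs = length (filter (λ a → p a Bool.≟ true) xs)

  count-∷ : ∀ (p : A → Bool) a xs → count p (a ∷ xs) ≡ 𝟙 (p a) + count p xs
  count-∷ p a xs with p a
  ... | true  = refl
  ... | false = refl

  count-∷-true : ∀ (p : A → Bool) a {xs} → p a ≡ true → count p (a ∷ xs) ≡ suc (count p xs)
  count-∷-true p a {xs} pa = trans (count-∷ p a xs) (cong (λ b → 𝟙 b + count p xs) pa)

  count-∷-false : ∀ (p : A → Bool) a {xs} → p a ≡ false → count p (a ∷ xs) ≡ count p xs
  count-∷-false p a {xs} pa = trans (count-∷ p a xs) (cong (λ b → 𝟙 b + count p xs) pa)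

  count-++ : ∀ (p : A → Bool) xs ys → count p (xs ++ ys) ≡ count p xs + count p ys
  count-++ p []       ys = refl
  count-++ p (a ∷ xs) ys = begin
    count p (a ∷ xs ++ ys)              ≡⟨ count-∷ p a (xs ++ ys) ⟩
    𝟙 (p a) + count p (xs ++ ys)        ≡⟨ cong (𝟙 (p a) +_) (count-++ p xs ys) ⟩
    𝟙 (p a) + (count p xs + count p ys) ≡⟨ +-assoc (𝟙 (p a)) _ _ ⟨
    (𝟙 (p a) + count p xs) + count p ys ≡⟨ cong (_+ count p ys) (count-∷ p a xs) ⟨
    count p (a ∷ xs) + count p ys       ∎
    where open ≡-Reasoning

  count-none : ∀ (p : A → Bool) xs → (∀ {a} → a ∈ xs → p a ≡ false) → count p xs ≡ 0
  count-none p []       _ = refl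
  count-none p (a ∷ xs) h
    rewrite count-∷ p a xs | h (here refl) = count-none p xs (h ∘ there)

  count-cong : ∀ (p q : A → Bool) xs → (∀ {a} → a ∈ xs → p a ≡ q a) → count p xs ≡ count q xs
  count-cong p q []       _ = refl
  count-cong p q (a ∷ xs) h
    rewrite count-∷ p a xs | count-∷ q a xs | h (here refl) = cong (𝟙 (q a) +_) (count-cong p q xs (h ∘ there))

  count-map : ∀ (p : ℕ → Bool) (f : A → ℕ) xs → count p (map f xs) ≡ count (p ∘ f) xs
  count-map p f []       = refl
  count-map p f (a ∷ xs)
    rewrite count-∷ p (f a) (map f xs) | count-∷ (p ∘ f) a xs = cong (𝟙 (p (f a)) +_) (count-map p f xs)

  +-<-∸ : ∀ m {n k} → k < n ∸ m → m + k < n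
  +-<-∸ zero          k<n = k<n
  +-<-∸ (suc m) {suc n} k<n = s≤s (+-<-∸ m k<n)

  ∈-between⁻ : ∀ {z} → z ∈ between x y → x < z × z < y
  ∈-between⁻ {x = x} {z = z} z∈ with ∈-map⁻ (suc x +_) z∈
  ... | k , k∈ , refl = s≤s (m≤m+n x k) , +-<-∸ (suc x) (∈-upTo⁻ k∈)

  ∈-between⁺ : ∀ {z} → x < z → z < y → z ∈ between x y
  ∈-between⁺ {x = x} {y = y} {z = z} x<z z<y = subst (_∈ between x y) (m+[n∸m]≡n x<z)
    (∈-map⁺ (suc x +_) (∈-upTo⁺ (∸-monoˡ-< z<y x<z)))

  applyUpTo-++ : ∀ (f : ℕ → A) m n → applyUpTo f (m + n) ≡ applyUpTo f m ++ applyUpTo (f ∘ (m +_)) n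
  applyUpTo-++ f zero    n = refl
  applyUpTo-++ f (suc m) n = cong (f 0 ∷_) (applyUpTo-++ (f ∘ suc) m n)

  upTo-split : ∀ {z} → z < n → upTo n ≡ upTo z ++ z ∷ between z n
  upTo-split {n = n} {z = z} z<n = begin
    upTo n                                                   ≡⟨ cong upTo n≡ ⟨
    upTo (z + suc d)                                         ≡⟨ applyUpTo-++ id z (suc d) ⟩
    upTo z ++ (z + 0) ∷ applyUpTo (λ i → z + suc i) d        ≡⟨ cong (λ w → upTo z ++ w ∷ applyUpTo (λ i → z + suc i) d) (+-identityʳ z) ⟩
    upTo z ++ z ∷ applyUpTo (λ i → z + suc i) d              ≡⟨ cong (λ w → upTo z ++ z ∷ w) (map-upTo _ d) ⟨
    upTo z ++ z ∷ map (λ i → z + suc i) (upTo d)             ≡⟨ cong (λ w → upTo z ++ z ∷ w) (map-cong (+-suc z) (upTo d)) ⟩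
    upTo z ++ z ∷ between z n                                ∎
    where
    open ≡-Reasoning
    d : ℕ
    d = n ∸ suc z
    n≡ : z + suc d ≡ n
    n≡ = trans (+-suc z d) (m+[n∸m]≡n z<n)

  between-split : ∀ {z} → x < z → z < n → between x n ≡ between x z ++ z ∷ between z n
  between-split {x = x} {n = n} {z = z} x<z z<n = ∷-injectiveʳ (++-cancelˡ (upTo x) _ _ (begin
    upTo x ++ x ∷ between x n                            ≡⟨ upTo-split (<-trans x<z z<n) ⟨
    upTo n                                               ≡⟨ upTo-split z<n ⟩
    upTo z ++ z ∷ between z n                            ≡⟨ cong (_++ z ∷ between z n) (upTo-split x<z) ⟩
    (upTo x ++ x ∷ between x z) ++ z ∷ between z n       ≡⟨ ++-assoc (upTo x) _ _ ⟩
    upTo x ++ x ∷ (between x z ++ z ∷ between z n)       ∎))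
    where open ≡-Reasoning

  count-between-split : ∀ (p : ℕ → Bool) {z} → x < z → z < n → (∀ {y} → x < y → y < z → p y ≡ false) →
                        count p (between x n) ≡ count p (z ∷ between z n)
  count-between-split {x = x} {n = n} p {z} x<z z<n h = begin
    count p (between x n)                              ≡⟨ cong (count p) (between-split x<z z<n) ⟩
    count p (between x z ++ z ∷ between z n)           ≡⟨ count-++ p (between x z) _ ⟩
    count p (between x z) + count p (z ∷ between z n)  ≡⟨ cong (_+ _) (count-none p (between x z) (uncurry h ∘ ∈-between⁻)) ⟩
    count p (z ∷ between z n)                          ∎
    where open ≡-Reasoning

  -- Records and the greedy walk

  isLRmin isRLmin : List ℕ → ℕ → Bool
  isLRmin τ i = all (λ j → at τ i <ᵇ at τ j) (upTo i)
  isRLmin τ i = noneBelow τ (at τ i) (between i (length τ))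

  module Minima (τ : List ℕ) where

    noneBelow-true⁻ : ∀ {z zs} → noneBelow τ v zs ≡ true → z ∈ zs → at τ z ≮ v
    noneBelow-true⁻ e z∈ = <ᵇ-false⁻ (not-injective {y = false} (all-true⁻ e z∈))

    noneBelow-true⁺ : ∀ v zs → (∀ {z} → z ∈ zs → at τ z ≮ v) → noneBelow τ v zs ≡ true
    noneBelow-true⁺ v zs h = all-true⁺ zs (cong not ∘ <ᵇ-false ∘ h)

    noneBelow-false⁺ : ∀ {z zs} → z ∈ zs → at τ z < v → noneBelow τ v zs ≡ false
    noneBelow-false⁺ z∈ z<v = all-false⁺ z∈ (cong not (<ᵇ-true z<v))

    isLRmin-true⁻ : isLRmin τ i ≡ true → j < i → at τ i < at τ j
    isLRmin-true⁻ e j<i = <ᵇ-true⁻ (all-true⁻ e (∈-upTo⁺ j<i))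

    isLRmin-true⁺ : (∀ {j} → j < i → at τ i < at τ j) → isLRmin τ i ≡ true
    isLRmin-true⁺ {i} h = all-true⁺ (upTo i) (<ᵇ-true ∘ h ∘ ∈-upTo⁻)

    isLRmin-false⁺ : j < i → at τ i ≮ at τ j → isLRmin τ i ≡ false
    isLRmin-false⁺ j<i h = all-false⁺ (∈-upTo⁺ j<i) (<ᵇ-false h)

    isRLmin-true⁻ : isRLmin τ i ≡ true → i < j → j < length τ → at τ j ≮ at τ i
    isRLmin-true⁻ e i<j j<N = noneBelow-true⁻ e (∈-between⁺ i<j j<N)

    isRLmin-true⁺ : (∀ {j} → i < j → j < length τ → at τ j ≮ at τ i) → isRLmin τ i ≡ true
    isRLmin-true⁺ {i} h = noneBelow-true⁺ (at τ i) (between i (length τ)) (uncurry h ∘ ∈-between⁻)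

    isRLmin-false⁺ : i < j → j < length τ → at τ j < at τ i → isRLmin τ i ≡ false
    isRLmin-false⁺ i<j j<N = noneBelow-false⁺ (∈-between⁺ i<j j<N)

    link-left : y < x → at τ y < at τ x → noneBelow τ (at τ x) (between y x) ≡ true → link τ x y ≡ true
    link-left y<x y↓ free rewrite <ᵇ-true y↓ | <ᵇ-true y<x | free = refl

    link-right : x < y → at τ y < at τ x → noneBelow τ (at τ x) (between x y) ≡ true → link τ x y ≡ true
    link-right x<y y↓ free rewrite <ᵇ-true y↓ | <ᵇ-false (<⇒≯ x<y) | <ᵇ-true x<y | free = refl

    link-above : at τ y ≮ at τ x → link τ x y ≡ false
    link-above y↑ rewrite <ᵇ-false y↑ = refl

    link-blockedʳ : ∀ {z} → x < z → z < y → at τ z < at τ x → link τ x y ≡ false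
    link-blockedʳ {x = x} {y = y} {z = z} x<z z<y z↓
      rewrite <ᵇ-false (<⇒≯ (<-trans x<z z<y)) | <ᵇ-true (<-trans x<z z<y)
            | noneBelow-false⁺ {zs = between x y} (∈-between⁺ x<z z<y) z↓ = ∧-zeroʳ _

    link-blockedˡ : ∀ {z} → y < z → z < x → at τ z < at τ x → link τ x y ≡ false
    link-blockedˡ {y = y} {x = x} {z = z} y<z z<x z↓
      rewrite <ᵇ-true (<-trans y<z z<x) | <ᵇ-false (<⇒≯ (<-trans y<z z<x))
            | noneBelow-false⁺ {zs = between y x} (∈-between⁺ y<z z<x) z↓ = ∧-zeroʳ _

  greedyStep : List ℕ → ℕ → ℕ → ℕ → ℕ → ℕ
  greedyStep τ t x y best = if adj τ x y ∧ ((best ≡ᵇ x) ∨ (∣ y - t ∣ <ᵇ ∣ best - t ∣)) then y else best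

  module Greedy (τ : List ℕ) (t : ℕ) {x : ℕ} where

    private
      step : ℕ → ℕ → ℕ
      step = greedyStep τ t x

    foldr-greedyStep-none : ∀ ys b → (∀ {y} → y ∈ ys → adj τ x y ≡ false) → foldr step b ys ≡ b
    foldr-greedyStep-none []       b _ = refl
    foldr-greedyStep-none (y ∷ ys) b h
      rewrite foldr-greedyStep-none ys b (h ∘ there) | h (here refl) = refl

    foldr-greedyStep-keep : ∀ ys {z} → x ≢ z → z ≤ t → (∀ {y} → y ∈ ys → y < z) → foldr step z ys ≡ z
    foldr-greedyStep-keep []       _   _   _ = refl
    foldr-greedyStep-keep (y ∷ ys) x≢z z≤t h
      rewrite foldr-greedyStep-keep ys x≢z z≤t (h ∘ there)
            | ≡ᵇ-false (x≢z ∘ sym)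
            | m≤n⇒∣m-n∣≡n∸m (≤-trans (<⇒≤ (h (here refl))) z≤t) | m≤n⇒∣m-n∣≡n∸m z≤t
            | <ᵇ-false (≤⇒≯ (∸-monoʳ-≤ t (<⇒≤ (h (here refl)))))
            | ∧-zeroʳ (adj τ x y) = refl

    greedyNext-rightmost : ∀ {z} → x < z → z ≤ t → z < length τ → adj τ x z ≡ true →
                           (∀ {y} → z < y → y < length τ → adj τ x y ≡ false) → greedyNext τ t x ≡ z
    greedyNext-rightmost {z} x<z z≤t z<N x~z far = begin
      foldr step x (upTo N)                                     ≡⟨ cong (foldr step x) (upTo-split z<N) ⟩
      foldr step x (upTo z ++ z ∷ between z N)                  ≡⟨ foldr-++ step x (upTo z) _ ⟩
      foldr step (step z (foldr step x (between z N))) (upTo z) ≡⟨ cong (λ b → foldr step (step z b) (upTo z)) none ⟩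
      foldr step (step z x) (upTo z)                            ≡⟨ cong (λ b → foldr step b (upTo z)) picks-z ⟩
      foldr step z (upTo z)                                     ≡⟨ foldr-greedyStep-keep (upTo z) (<⇒≢ x<z) z≤t ∈-upTo⁻ ⟩
      z                                                         ∎
      where
      open ≡-Reasoning
      N : ℕ
      N = length τ
      none : foldr step x (between z N) ≡ x
      none = foldr-greedyStep-none (between z N) x (uncurry far ∘ ∈-between⁻)
      picks-z : step z x ≡ z
      picks-z rewrite x~z | ≡ᵇ-refl x = refl

  data FirstAfter (p : ℕ → Bool) (x j : ℕ) : Set where
    none  : (∀ {y} → x < y → y ≤ j → p y ≡ false) → FirstAfter p x j
    first : ∀ z → x < z → z ≤ j → p z ≡ true → (∀ {y} → x < y → y < z → p y ≡ false) → FirstAfter p x j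

  firstAfter : ∀ p x j → FirstAfter p x j
  firstAfter p x zero = none (λ x<y y≤0 → ⊥-elim (n≮0 (<-≤-trans x<y y≤0)))
  firstAfter p x (suc j) with firstAfter p x j
  ... | first z x<z z≤j pz before = first z x<z (m≤n⇒m≤1+n z≤j) pz before
  ... | none h with p (suc j) in e | x <? suc j
  ...   | true  | yes x<j+1 = first (suc j) x<j+1 ≤-refl e (λ x<y y<j+1 → h x<y (≤-pred y<j+1))
  ...   | true  | no  x≮j+1 = none (λ x<y y≤j+1 → ⊥-elim (x≮j+1 (<-≤-trans x<y y≤j+1)))
  ...   | false | _          = none (λ x<y y≤j+1 → [ (λ y<j+1 → h x<y (≤-pred y<j+1)) , (λ { refl → e }) ]′
                                                      (m≤n⇒m<n∨m≡n y≤j+1))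

  module Walk (τ : List ℕ) (t : ℕ) (length≡ : length τ ≡ suc t)
              (at-injective : ∀ {i j} → i < length τ → j < length τ → at τ i ≡ at τ j → i ≡ j) where

    open Minima τ
    open Greedy τ t

    private
      N : ℕ
      N = length τ

      ≤t⇒<N : i ≤ t → i < N
      ≤t⇒<N i≤t = subst (_ <_) (sym length≡) (s≤s i≤t)

      <N⇒≤t : i < N → i ≤ t
      <N⇒≤t i<N = ≤-pred (subst (_ <_) length≡ i<N)

      at-<-≢ : i < N → j < N → i ≢ j → at τ j ≮ at τ i → at τ i < at τ j
      at-<-≢ i<N j<N i≢j j≮i = ≤∧≢⇒< (≮⇒≥ j≮i) (i≢j ∘ at-injective i<N j<N)

    IsRecord : ℕ → Set
    IsRecord x = isLRmin τ x ≡ true ⊎ isRLmin τ x ≡ true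

    minimaAhead : ℕ → ℕ
    minimaAhead x = count (isLRmin τ) (between x N) + count (isRLmin τ) (x ∷ between x N)

    record Step (x : ℕ) : Set where
      field
        next        : ℕ
        greedy      : greedyNext τ t x ≡ next
        x<next      : x < next
        next≤t      : next ≤ t
        next-record : IsRecord next
        ahead       : minimaAhead x ≡ suc (minimaAhead next)

    stepRL : x < t → isRLmin τ x ≡ true → Step x
    stepRL {x} x<t rl = record
      { next        = z
      ; greedy      = greedyNext-rightmost x<z (<N⇒≤t z<N) z<N x~z far
      ; x<next      = x<z
      ; next≤t      = <N⇒≤t z<N
      ; next-record = inj₂ rl-z
      ; ahead       = ahead-eq
      }
      where
      z : ℕ
      z = argmin (at τ) (suc x) (between x N)

      z∈ : z ∈ between x N
      z∈ = argmin-all (at τ) (∈-between⁺ ≤-refl (≤t⇒<N x<t)) (All.tabulate id)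

      x<z : x < z
      x<z = proj₁ (∈-between⁻ {y = N} z∈)

      z<N : z < N
      z<N = proj₂ (∈-between⁻ {x = x} z∈)

      z-min : x < y → y < N → at τ z ≤ at τ y
      z-min x<y y<N = All.lookup (f[argmin]≤f[xs] {f = at τ} (suc x) (between x N)) (∈-between⁺ x<y y<N)

      z-min-strict : x < y → y < N → z ≢ y → at τ z < at τ y
      z-min-strict x<y y<N z≢y = at-<-≢ z<N y<N z≢y (≤⇒≯ (z-min x<y y<N))

      x-below : x < y → y < N → at τ x < at τ y
      x-below x<y y<N = at-<-≢ (<-trans x<y y<N) y<N (<⇒≢ x<y) (isRLmin-true⁻ rl x<y y<N)

      x~z : adj τ x z ≡ true
      x~z = trans (cong (link τ x z ∨_) z→x) (∨-zeroʳ _)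
        where
        z→x : link τ z x ≡ true
        z→x = link-left x<z (x-below x<z z<N) (noneBelow-true⁺ (at τ z) (between x z)
                (λ y∈ → let x<y , y<z = ∈-between⁻ y∈ in ≤⇒≯ (z-min x<y (<-trans y<z z<N))))

      far : z < y → y < N → adj τ x y ≡ false
      far z<y y<N = cong₂ _∨_ (link-above (<⇒≯ (x-below (<-trans x<z z<y) y<N)))
                              (link-blockedˡ x<z z<y (z-min-strict (<-trans x<z z<y) y<N (<⇒≢ z<y)))

      rl-z : isRLmin τ z ≡ true
      rl-z = isRLmin-true⁺ (λ z<y y<N → ≤⇒≯ (z-min (<-trans x<z z<y) y<N))

      ahead-eq : minimaAhead x ≡ suc (minimaAhead z)
      ahead-eq = trans (cong₂ _+_ lr-part rl-part) (+-suc _ _)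
        where
        lr-part : count (isLRmin τ) (between x N) ≡ count (isLRmin τ) (between z N)
        lr-part = trans (count-between-split (isLRmin τ) x<z z<N
                           (λ x<y y<z → isLRmin-false⁺ x<y (<⇒≯ (x-below x<y (<-trans y<z z<N)))))
                        (count-∷-false (isLRmin τ) z (isLRmin-false⁺ x<z (<⇒≯ (x-below x<z z<N))))
        rl-part : count (isRLmin τ) (x ∷ between x N) ≡ suc (count (isRLmin τ) (z ∷ between z N))
        rl-part = trans (count-∷-true (isRLmin τ) x rl) (cong suc (count-between-split (isRLmin τ) x<z z<N
                    (λ x<y y<z → isRLmin-false⁺ y<z z<N (z-min-strict x<y (<-trans y<z z<N) (<⇒≢ y<z ∘ sym)))))

    stepLR : x < t → isLRmin τ x ≡ true → isRLmin τ x ≡ false → Step x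
    stepLR {x} x<t lr ¬rl with firstAfter (λ y → at τ y <ᵇ at τ x) x t
    ... | none h = ⊥-elim (not-¬ ¬rl (isRLmin-true⁺ (λ x<y y<N → <ᵇ-false⁻ (h x<y (<N⇒≤t y<N)))))
    ... | first z x<z z≤t z↓ before = record
      { next        = z
      ; greedy      = greedyNext-rightmost x<z z≤t z<N x~z far
      ; x<next      = x<z
      ; next≤t      = z≤t
      ; next-record = inj₁ lr-z
      ; ahead       = ahead-eq
      }
      where
      z<N : z < N
      z<N = ≤t⇒<N z≤t

      z-below : at τ z < at τ x
      z-below = <ᵇ-true⁻ z↓

      x-below : x < y → y < z → at τ x < at τ y
      x-below x<y y<z = at-<-≢ (<-trans x<y (<-trans y<z z<N)) (<-trans y<z z<N) (<⇒≢ x<y) (<ᵇ-false⁻ (before x<y y<z))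

      x~z : adj τ x z ≡ true
      x~z = cong (_∨ link τ z x) (link-right x<z z-below (noneBelow-true⁺ (at τ x) (between x z)
              (λ y∈ → <ᵇ-false⁻ (uncurry before (∈-between⁻ y∈)))))

      far : z < y → y < N → adj τ x y ≡ false
      far {y} z<y y<N = cong₂ _∨_ (link-blockedʳ x<z z<y z-below) y→x
        where
        y→x : link τ y x ≡ false
        y→x with at τ x <? at τ y
        ... | yes x<y = link-blockedˡ x<z z<y (<-trans z-below x<y)
        ... | no  x≮y = link-above x≮y

      lr-z : isLRmin τ z ≡ true
      lr-z = isLRmin-true⁺ below-all
        where
        below-all : j < z → at τ z < at τ j
        below-all {j} j<z with <-cmp j x
        ... | tri< j<x _ _ = <-trans z-below (isLRmin-true⁻ lr j<x)
        ... | tri≈ _ refl _ = z-below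
        ... | tri> _ _ x<j = <-trans z-below (x-below x<j j<z)

      ahead-eq : minimaAhead x ≡ suc (minimaAhead z)
      ahead-eq = cong₂ _+_ lr-part rl-part
        where
        lr-part : count (isLRmin τ) (between x N) ≡ suc (count (isLRmin τ) (between z N))
        lr-part = trans (count-between-split (isLRmin τ) x<z z<N
                           (λ x<y y<z → isLRmin-false⁺ x<y (<⇒≯ (x-below x<y y<z))))
                        (count-∷-true (isLRmin τ) z lr-z)
        rl-part : count (isRLmin τ) (x ∷ between x N) ≡ count (isRLmin τ) (z ∷ between z N)
        rl-part = trans (count-∷-false (isRLmin τ) x ¬rl) (count-between-split (isRLmin τ) x<z z<N
                    (λ x<y y<z → isRLmin-false⁺ y<z z<N (<-trans z-below (x-below x<y y<z))))

    step : x < t → IsRecord x → Step x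
    step {x} x<t rec with isRLmin τ x in rl | rec
    ... | true  | _       = stepRL x<t rl
    ... | false | inj₁ lr = stepLR x<t lr rl

    walk-ahead : ∀ f → IsRecord x → x ≤ t → t < x + f → suc (walk τ t f x) ≡ minimaAhead x
    walk-ahead {x} zero _ x≤t t<x+0 = ⊥-elim (<⇒≱ (subst (t <_) (+-identityʳ x) t<x+0) x≤t)
    walk-ahead {x} (suc f) rec x≤t t<x+f+1 with x ≟ t
    ... | yes refl rewrite ≡ᵇ-refl x =
      sym (cong₂ _+_ (nothing-after (isLRmin τ)) (trans (count-∷-true (isRLmin τ) x rl-t) (cong suc (nothing-after (isRLmin τ)))))
      where
      nothing-after : ∀ p → count p (between x N) ≡ 0
      nothing-after p = count-none p (between x N) (λ y∈ → let x<y , y<N = ∈-between⁻ y∈ in ⊥-elim (<⇒≱ x<y (<N⇒≤t y<N)))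
      rl-t : isRLmin τ x ≡ true
      rl-t = isRLmin-true⁺ (λ x<y y<N → ⊥-elim (<⇒≱ x<y (<N⇒≤t y<N)))
    ... | no x≢t rewrite ≡ᵇ-false x≢t = begin
      suc (suc (walk τ t f (greedyNext τ t x)))  ≡⟨ cong (λ y → suc (suc (walk τ t f y))) greedy ⟩
      suc (suc (walk τ t f next))                ≡⟨ cong suc (walk-ahead f next-record next≤t fuel) ⟩
      suc (minimaAhead next)                     ≡⟨ ahead ⟨
      minimaAhead x                              ∎
      where
      open ≡-Reasoning
      open Step (step (≤∧≢⇒< x≤t x≢t) rec)
      fuel : t < next + f
      fuel = <-≤-trans t<x+f+1 (≤-trans (≤-reflexive (+-suc x f)) (+-monoˡ-≤ f x<next))

    S+2≡L+R : S τ + 2 ≡ L τ + R τ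
    S+2≡L+R = begin
      S τ + 2                                     ≡⟨ +-comm (S τ) 2 ⟩
      suc (suc (S τ))                             ≡⟨ cong (λ n → suc (suc (walk τ (n ∸ 1) n 0))) length≡ ⟩
      suc (suc (walk τ t (suc t) 0))              ≡⟨ cong suc (walk-ahead (suc t) (inj₁ refl) z≤n ≤-refl) ⟩
      suc (minimaAhead 0)                         ≡⟨ cong₂ (λ as bs → count (isLRmin τ) as + count (isRLmin τ) bs) split split ⟨
      L τ + R τ                                   ∎
      where
      open ≡-Reasoning
      split : upTo N ≡ 0 ∷ between 0 N
      split = upTo-split (≤t⇒<N z≤n)

  -- Inserting the maximum

  -- Positions past the end insert at the end (only `k ≤ length xs` is used).
  insertAtℕ : List A → ℕ → A → List A
  insertAtℕ xs       zero    v = v ∷ xs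
  insertAtℕ []       (suc k) v = v ∷ []
  insertAtℕ (a ∷ xs) (suc k) v = a ∷ insertAtℕ xs k v

  insertions≡map-insertAtℕ : ∀ v (xs : List ℕ) → insertions v xs ≡ map (λ k → insertAtℕ xs k v) (upTo (suc (length xs)))
  insertions≡map-insertAtℕ v []       = refl
  insertions≡map-insertAtℕ v (a ∷ xs) = cong ((v ∷ a ∷ xs) ∷_) (begin
    map (a ∷_) (insertions v xs)                                    ≡⟨ cong (map (a ∷_)) (insertions≡map-insertAtℕ v xs) ⟩
    map (a ∷_) (map (λ k → insertAtℕ xs k v) (upTo (suc ℓ)))        ≡⟨ map-∘ (upTo (suc ℓ)) ⟨
    map (λ k → a ∷ insertAtℕ xs k v) (upTo (suc ℓ))                 ≡⟨ map-upTo _ (suc ℓ) ⟩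
    applyUpTo (λ k → a ∷ insertAtℕ xs k v) (suc ℓ)                  ≡⟨ map-applyUpTo suc _ (suc ℓ) ⟨
    map (λ k → insertAtℕ (a ∷ xs) k v) (applyUpTo suc (suc ℓ))      ∎)
    where
    open ≡-Reasoning
    ℓ : ℕ
    ℓ = length xs

  ∈-insertions⁻ : ∀ {σ} v (xs : List ℕ) → σ ∈ insertions v xs → σ ↭ v ∷ xs
  ∈-insertions⁻ v []       (here refl) = ↭-refl
  ∈-insertions⁻ v (a ∷ xs) (here refl) = ↭-refl
  ∈-insertions⁻ v (a ∷ xs) (there σ∈) with ∈-map⁻ (a ∷_) σ∈
  ... | σ′ , σ′∈ , refl = ↭-trans (↭-prep a (∈-insertions⁻ v xs σ′∈)) (↭-swap a v ↭-refl)

  perms-↭ : ∀ n {σ} → σ ∈ perms n → σ ↭ upTo n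
  perms-↭ zero    (here refl) = ↭-refl
  perms-↭ (suc n) {σ} σ∈ with ∈-concat⁻′ (map (insertions n) (perms n)) σ∈
  ... | _ , σ∈ins , ins∈ with ∈-map⁻ (insertions n) ins∈
  ...   | τ , τ∈ , refl = begin
    σ                ↭⟨ ∈-insertions⁻ n τ σ∈ins ⟩
    n ∷ τ            ↭⟨ ↭-prep n (perms-↭ n τ∈) ⟩
    n ∷ upTo n       ↭⟨ ∷↭∷ʳ n (upTo n) ⟩
    upTo n ∷ʳ n      ≡⟨ upTo-∷ʳ n ⟩
    upTo (suc n)     ∎
    where open PermutationReasoning

  module _ (n : ℕ) {σ : List ℕ} (σ∈ : σ ∈ perms n) where

    perms-length : length σ ≡ n
    perms-length = trans (↭-length (perms-↭ n σ∈)) (length-upTo n)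

    perms-bounded : All (_< n) σ
    perms-bounded = All.tabulate (λ w∈ → ∈-upTo⁻ (∈-resp-↭ (perms-↭ n σ∈) w∈))

    perms-unique : Unique σ
    perms-unique = Unique-resp-↭ (↭⇒↭ₛ (↭-sym (perms-↭ n σ∈))) (upTo⁺ n)

  at-∈ : ∀ (xs : List ℕ) {i} → i < length xs → at xs i ∈ xs
  at-∈ (a ∷ xs) {zero}  _         = here refl
  at-∈ (a ∷ xs) {suc i} (s≤s i<n) = there (at-∈ xs i<n)

  Unique⇒at-injective : ∀ {xs : List ℕ} → Unique xs → ∀ {i j} → i < length xs → j < length xs → at xs i ≡ at xs j → i ≡ j
  Unique⇒at-injective {a ∷ xs} _        {zero}  {zero}  _         _         _ = refl
  Unique⇒at-injective {a ∷ xs} (a∉ ∷ _) {zero}  {suc j} _         (s≤s j<n) e = ⊥-elim (All.lookup a∉ (at-∈ xs j<n) e)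
  Unique⇒at-injective {a ∷ xs} (a∉ ∷ _) {suc i} {zero}  (s≤s i<n) _         e = ⊥-elim (All.lookup a∉ (at-∈ xs i<n) (sym e))
  Unique⇒at-injective {a ∷ xs} (_ ∷ u)  {suc i} {suc j} (s≤s i<n) (s≤s j<n) e = cong suc (Unique⇒at-injective u i<n j<n e)

  S+2≡L+R : ∀ n {τ} → τ ∈ perms (suc n) → S τ + 2 ≡ L τ + R τ
  S+2≡L+R n {τ} τ∈ = Walk.S+2≡L+R τ n (perms-length (suc n) τ∈) (Unique⇒at-injective (perms-unique (suc n) τ∈))

  all-at : ∀ (p : ℕ → Bool) (xs : List ℕ) → all (p ∘ at xs) (upTo (length xs)) ≡ all p xs
  all-at p []       = refl
  all-at p (a ∷ xs) = cong (p a ∧_) (begin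
    all (p ∘ at (a ∷ xs)) (applyUpTo suc (length xs))  ≡⟨ cong (all _) (map-upTo suc (length xs)) ⟨
    all (p ∘ at (a ∷ xs)) (map suc (upTo (length xs)))  ≡⟨ all-map _ suc (upTo (length xs)) ⟩
    all (p ∘ at xs) (upTo (length xs))                  ≡⟨ all-at p xs ⟩
    all p xs                                            ∎)
    where open ≡-Reasoning

  all-insertAtℕ : ∀ (p : A → Bool) xs k v → all p (insertAtℕ xs k v) ≡ p v ∧ all p xs
  all-insertAtℕ p xs       zero    v = refl
  all-insertAtℕ p []       (suc k) v = refl
  all-insertAtℕ p (a ∷ xs) (suc k) v rewrite all-insertAtℕ p xs k v with p a | p v
  ... | true  | _     = refl
  ... | false | true  = refl
  ... | false | false = refl

  count-upTo-suc : ∀ (p : ℕ → Bool) n → count p (upTo (suc n)) ≡ 𝟙 (p 0) + count (p ∘ suc) (upTo n)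
  count-upTo-suc p n = trans (count-∷ p 0 (applyUpTo suc n))
    (cong (𝟙 (p 0) +_) (trans (cong (count p) (sym (map-upTo suc n))) (count-map p suc (upTo n))))

  countLRmin : (ℕ → Bool) → List ℕ → ℕ
  countLRmin c xs = count (λ i → c (at xs i) ∧ isLRmin xs i) (upTo (length xs))

  isLRmin-∷ : ∀ a (xs : List ℕ) i → isLRmin (a ∷ xs) (suc i) ≡ (at xs i <ᵇ a) ∧ isLRmin xs i
  isLRmin-∷ a xs i = cong ((at xs i <ᵇ a) ∧_) (begin
    all (λ j → at xs i <ᵇ at (a ∷ xs) j) (applyUpTo suc i)  ≡⟨ cong (all _) (map-upTo suc i) ⟨
    all (λ j → at xs i <ᵇ at (a ∷ xs) j) (map suc (upTo i)) ≡⟨ all-map _ suc (upTo i) ⟩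
    isLRmin xs i                                            ∎)
    where open ≡-Reasoning

  countLRmin-∷ : ∀ c a xs → countLRmin c (a ∷ xs) ≡ 𝟙 (c a) + countLRmin (λ w → c w ∧ (w <ᵇ a)) xs
  countLRmin-∷ c a xs = trans (count-upTo-suc (λ i → c (at (a ∷ xs) i) ∧ isLRmin (a ∷ xs) i) (length xs))
    (cong₂ (λ b m → 𝟙 b + m) (∧-identityʳ (c a)) (count-cong _ _ (upTo (length xs)) (λ {i} _ → shift i)))
    where
    shift : ∀ i → c (at xs i) ∧ isLRmin (a ∷ xs) (suc i) ≡ (c (at xs i) ∧ (at xs i <ᵇ a)) ∧ isLRmin xs i
    shift i = trans (cong (c (at xs i) ∧_) (isLRmin-∷ a xs i)) (sym (∧-assoc (c (at xs i)) _ _))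

  countLRmin-cong : ∀ c c′ (xs : List ℕ) → (∀ {w} → w ∈ xs → c w ≡ c′ w) → countLRmin c xs ≡ countLRmin c′ xs
  countLRmin-cong c c′ xs h = count-cong _ _ (upTo (length xs))
    (λ {i} i∈ → cong (_∧ isLRmin xs i) (h (at-∈ xs (∈-upTo⁻ i∈))))

  countLRmin-insertAtℕ : ∀ c (xs : List ℕ) k v → k ≤ length xs → All (_< v) xs →
                         countLRmin c (insertAtℕ xs k v) ≡ 𝟙 ((k ≡ᵇ 0) ∧ c v) + countLRmin c xs
  countLRmin-insertAtℕ c xs zero v _ xs<v = trans (countLRmin-∷ c v xs) (cong (𝟙 (c v) +_)
    (countLRmin-cong _ c xs (λ {w} w∈ → trans (cong (c w ∧_) (<ᵇ-true (All.lookup xs<v w∈))) (∧-identityʳ (c w)))))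
  countLRmin-insertAtℕ c (a ∷ xs) (suc k) v (s≤s k≤n) (a<v ∷ xs<v) = begin
    countLRmin c (a ∷ insertAtℕ xs k v)
      ≡⟨ countLRmin-∷ c a (insertAtℕ xs k v) ⟩
    𝟙 (c a) + countLRmin c′ (insertAtℕ xs k v)
      ≡⟨ cong (𝟙 (c a) +_) (countLRmin-insertAtℕ c′ xs k v k≤n xs<v) ⟩
    𝟙 (c a) + (𝟙 ((k ≡ᵇ 0) ∧ (c v ∧ (v <ᵇ a))) + countLRmin c′ xs)
      ≡⟨ cong (λ b → 𝟙 (c a) + (𝟙 b + countLRmin c′ xs)) v-not-min ⟩
    𝟙 (c a) + countLRmin c′ xs
      ≡⟨ countLRmin-∷ c a xs ⟨
    countLRmin c (a ∷ xs)
      ∎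
    where
    open ≡-Reasoning
    c′ : ℕ → Bool
    c′ w = c w ∧ (w <ᵇ a)
    v-not-min : (k ≡ᵇ 0) ∧ (c v ∧ (v <ᵇ a)) ≡ false
    v-not-min rewrite <ᵇ-false (<⇒≯ a<v) | ∧-zeroʳ (c v) = ∧-zeroʳ (k ≡ᵇ 0)

  L-insertAtℕ : ∀ (xs : List ℕ) k v → k ≤ length xs → All (_< v) xs → L (insertAtℕ xs k v) ≡ 𝟙 (k ≡ᵇ 0) + L xs
  L-insertAtℕ xs k v k≤n xs<v =
    trans (countLRmin-insertAtℕ (λ _ → true) xs k v k≤n xs<v) (cong (λ b → 𝟙 b + L xs) (∧-identityʳ (k ≡ᵇ 0)))

  isRLmin-∷-zero : ∀ a (xs : List ℕ) → isRLmin (a ∷ xs) 0 ≡ all (λ w → not (w <ᵇ a)) xs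
  isRLmin-∷-zero a xs = trans (all-map _ suc (upTo (length xs))) (all-at (λ w → not (w <ᵇ a)) xs)

  isRLmin-∷ : ∀ a (xs : List ℕ) i → isRLmin (a ∷ xs) (suc i) ≡ isRLmin xs i
  isRLmin-∷ a xs i = trans (all-map _ (suc (suc i) +_) (upTo (length xs ∸ suc i)))
                           (sym (all-map _ (suc i +_) (upTo (length xs ∸ suc i))))

  R-∷ : ∀ a xs → R (a ∷ xs) ≡ 𝟙 (all (λ w → not (w <ᵇ a)) xs) + R xs
  R-∷ a xs = trans (count-upTo-suc (isRLmin (a ∷ xs)) (length xs))
    (cong₂ (λ b m → 𝟙 b + m) (isRLmin-∷-zero a xs) (count-cong _ _ (upTo (length xs)) (λ {i} _ → isRLmin-∷ a xs i)))

  R-insertAtℕ : ∀ (xs : List ℕ) k v → k ≤ length xs → All (_< v) xs → R (insertAtℕ xs k v) ≡ 𝟙 (k ≡ᵇ length xs) + R xs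
  R-insertAtℕ []       zero    v _ _            = refl
  R-insertAtℕ (a ∷ xs) zero    v _ (a<v ∷ _)    =
    trans (R-∷ v (a ∷ xs)) (cong (λ b → 𝟙 (not b ∧ all (λ w → not (w <ᵇ v)) xs) + R (a ∷ xs)) (<ᵇ-true a<v))
  R-insertAtℕ (a ∷ xs) (suc k) v (s≤s k≤n) (a<v ∷ xs<v) = begin
    R (a ∷ insertAtℕ xs k v)
      ≡⟨ R-∷ a (insertAtℕ xs k v) ⟩
    𝟙 (all q (insertAtℕ xs k v)) + R (insertAtℕ xs k v)
      ≡⟨ cong₂ (λ b m → 𝟙 b + m) (all-insertAtℕ q xs k v) (R-insertAtℕ xs k v k≤n xs<v) ⟩
    𝟙 (not (v <ᵇ a) ∧ all q xs) + (𝟙 (k ≡ᵇ length xs) + R xs)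
      ≡⟨ cong (λ b → 𝟙 (not b ∧ all q xs) + (𝟙 (k ≡ᵇ length xs) + R xs)) (<ᵇ-false (<⇒≯ a<v)) ⟩
    𝟙 (all q xs) + (𝟙 (k ≡ᵇ length xs) + R xs)
      ≡⟨ x∙yz≈y∙xz (𝟙 (all q xs)) (𝟙 (k ≡ᵇ length xs)) (R xs) ⟩
    𝟙 (k ≡ᵇ length xs) + (𝟙 (all q xs) + R xs)
      ≡⟨ cong (𝟙 (k ≡ᵇ length xs) +_) (R-∷ a xs) ⟨
    𝟙 (k ≡ᵇ length xs) + R (a ∷ xs)
      ∎
    where
    open ≡-Reasoning
    q : ℕ → Bool
    q w = not (w <ᵇ a)

  -- Sums over permutations

  ∑ : List A → (A → ℕ) → ℕ
  ∑ []       f = 0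
  ∑ (a ∷ xs) f = f a + ∑ xs f

  syntax ∑ xs (λ a → e) = ∑[ a ∈ xs ] e

  ∑-++ : ∀ (xs ys : List A) f → ∑ (xs ++ ys) f ≡ ∑ xs f + ∑ ys f
  ∑-++ []       ys f = refl
  ∑-++ (a ∷ xs) ys f = trans (cong (f a +_) (∑-++ xs ys f)) (sym (+-assoc (f a) _ _))

  ∑-cong : ∀ (xs : List A) {f g} → (∀ {a} → a ∈ xs → f a ≡ g a) → ∑ xs f ≡ ∑ xs g
  ∑-cong []       _ = refl
  ∑-cong (a ∷ xs) h = cong₂ _+_ (h (here refl)) (∑-cong xs (h ∘ there))

  ∑-+ : ∀ (xs : List A) f g → ∑[ a ∈ xs ] (f a + g a) ≡ ∑ xs f + ∑ xs g
  ∑-+ []       f g = refl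
  ∑-+ (a ∷ xs) f g = trans (cong (f a + g a +_) (∑-+ xs f g)) (interchange (f a) (g a) (∑ xs f) (∑ xs g))

  ∑-*ˡ : ∀ c (xs : List A) f → ∑[ a ∈ xs ] (c * f a) ≡ c * ∑ xs f
  ∑-*ˡ c []       f = sym (*-zeroʳ c)
  ∑-*ˡ c (a ∷ xs) f = trans (cong (c * f a +_) (∑-*ˡ c xs f)) (sym (*-distribˡ-+ c (f a) (∑ xs f)))

  ∑-const : ∀ (xs : List A) c → ∑[ _ ∈ xs ] c ≡ length xs * c
  ∑-const []       c = refl
  ∑-const (a ∷ xs) c = cong (c +_) (∑-const xs c)

  ∑-𝟙 : ∀ (p : A → Bool) xs → ∑[ a ∈ xs ] 𝟙 (p a) ≡ count p xs
  ∑-𝟙 p []       = refl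
  ∑-𝟙 p (a ∷ xs) = trans (cong (𝟙 (p a) +_) (∑-𝟙 p xs)) (sym (count-∷ p a xs))

  ∑-map : ∀ {B : Set} (g : B → A) xs f → ∑ (map g xs) f ≡ ∑ xs (f ∘ g)
  ∑-map g []       f = refl
  ∑-map g (b ∷ xs) f = cong (f (g b) +_) (∑-map g xs f)

  ∑-concatMap : ∀ {B : Set} (g : B → List A) xs f → ∑ (concatMap g xs) f ≡ ∑[ b ∈ xs ] ∑ (g b) f
  ∑-concatMap g []       f = refl
  ∑-concatMap g (b ∷ xs) f = trans (∑-++ (g b) (concatMap g xs) f) (cong (∑ (g b) f +_) (∑-concatMap g xs f))

  ∑-perms-suc : ∀ n g → ∑[ σ ∈ perms (suc n) ] g σ ≡ ∑[ τ ∈ perms n ] ∑[ k ∈ upTo (suc n) ] g (insertAtℕ τ k n)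
  ∑-perms-suc n g = trans (∑-concatMap (insertions n) (perms n) g) (∑-cong (perms n) (λ {τ} τ∈ → begin
    ∑ (insertions n τ) g
      ≡⟨ cong (λ σs → ∑ σs g) (insertions≡map-insertAtℕ n τ) ⟩
    ∑ (map (λ k → insertAtℕ τ k n) (upTo (suc (length τ)))) g
      ≡⟨ ∑-map (λ k → insertAtℕ τ k n) (upTo (suc (length τ))) g ⟩
    ∑[ k ∈ upTo (suc (length τ)) ] g (insertAtℕ τ k n)
      ≡⟨ cong (λ m → ∑[ k ∈ upTo (suc m) ] g (insertAtℕ τ k n)) (perms-length n τ∈) ⟩
    ∑[ k ∈ upTo (suc n) ] g (insertAtℕ τ k n)
      ∎))
    where open ≡-Reasoning

  length-perms : ∀ n → length (perms n) ≡ n !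
  length-perms zero    = refl
  length-perms (suc n) = begin
    length (perms (suc n))                          ≡⟨ *-identityʳ _ ⟨
    length (perms (suc n)) * 1                      ≡⟨ ∑-const (perms (suc n)) 1 ⟨
    ∑[ σ ∈ perms (suc n) ] 1                        ≡⟨ ∑-perms-suc n (λ _ → 1) ⟩
    ∑[ τ ∈ perms n ] ∑[ k ∈ upTo (suc n) ] 1        ≡⟨ ∑-cong (perms n) (λ _ → ∑-const (upTo (suc n)) 1) ⟩
    ∑[ τ ∈ perms n ] (length (upTo (suc n)) * 1)    ≡⟨ ∑-const (perms n) _ ⟩
    length (perms n) * (length (upTo (suc n)) * 1)  ≡⟨ cong₂ (λ a b → a * (b * 1)) (length-perms n) (length-upTo (suc n)) ⟩
    n ! * (suc n * 1)                               ≡⟨ cong (n ! *_) (*-identityʳ (suc n)) ⟩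
    n ! * suc n                                     ≡⟨ *-comm (n !) (suc n) ⟩
    suc n !                                         ∎
    where open ≡-Reasoning

  ∑-perms-step : ∀ n g h → (∀ {τ} → τ ∈ perms n → ∑[ k ∈ upTo (suc n) ] g (insertAtℕ τ k n) ≡ suc n * g τ + h τ) →
                 ∑[ σ ∈ perms (suc n) ] g σ ≡ suc n * ∑[ τ ∈ perms n ] g τ + ∑[ τ ∈ perms n ] h τ
  ∑-perms-step n g h inner = begin
    ∑[ σ ∈ perms (suc n) ] g σ                                        ≡⟨ ∑-perms-suc n g ⟩
    ∑[ τ ∈ perms n ] ∑[ k ∈ upTo (suc n) ] g (insertAtℕ τ k n)        ≡⟨ ∑-cong (perms n) inner ⟩
    ∑[ τ ∈ perms n ] (suc n * g τ + h τ)                              ≡⟨ ∑-+ (perms n) _ h ⟩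
    ∑[ τ ∈ perms n ] (suc n * g τ) + ∑[ τ ∈ perms n ] h τ             ≡⟨ cong (_+ _) (∑-*ˡ (suc n) (perms n) g) ⟩
    suc n * ∑[ τ ∈ perms n ] g τ + ∑[ τ ∈ perms n ] h τ               ∎
    where open ≡-Reasoning

  record JumpsAt (F : List ℕ → ℕ) (n j : ℕ) : Set where
    field
      j≤n  : j ≤ n
      jump : ∀ {τ} → τ ∈ perms n → ∀ {k} → k ≤ n → F (insertAtℕ τ k n) ≡ 𝟙 (k ≡ᵇ j) + F τ

  L-jumps : ∀ n → JumpsAt L n 0
  L-jumps n = record { j≤n = z≤n ; jump = λ τ∈ {k} k≤n →
    L-insertAtℕ _ k n (subst (k ≤_) (sym (perms-length n τ∈)) k≤n) (perms-bounded n τ∈) }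

  R-jumps : ∀ n → JumpsAt R n n
  R-jumps n = record { j≤n = ≤-refl ; jump = λ {τ} τ∈ {k} k≤n →
    trans (R-insertAtℕ τ k n (subst (k ≤_) (sym (perms-length n τ∈)) k≤n) (perms-bounded n τ∈))
          (cong (λ m → 𝟙 (k ≡ᵇ m) + R τ) (perms-length n τ∈)) }

  ∑-𝟙≡ᵇ : j ≤ n → ∑[ k ∈ upTo (suc n) ] 𝟙 (k ≡ᵇ j) ≡ 1
  ∑-𝟙≡ᵇ {j} {n} j≤n = begin
    ∑[ k ∈ upTo (suc n) ] 𝟙 (k ≡ᵇ j)                               ≡⟨ ∑-𝟙 (_≡ᵇ j) (upTo (suc n)) ⟩
    count (_≡ᵇ j) (upTo (suc n))                                    ≡⟨ cong (count (_≡ᵇ j)) (upTo-split (s≤s j≤n)) ⟩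
    count (_≡ᵇ j) (upTo j ++ j ∷ between j (suc n))                 ≡⟨ count-++ (_≡ᵇ j) (upTo j) _ ⟩
    count (_≡ᵇ j) (upTo j) + count (_≡ᵇ j) (j ∷ between j (suc n))  ≡⟨ cong₂ _+_ none-before (count-∷-true (_≡ᵇ j) j (≡ᵇ-refl j)) ⟩
    suc (count (_≡ᵇ j) (between j (suc n)))                         ≡⟨ cong suc none-after ⟩
    1                                                               ∎
    where
    open ≡-Reasoning
    none-before : count (_≡ᵇ j) (upTo j) ≡ 0
    none-before = count-none (_≡ᵇ j) (upTo j) (≡ᵇ-false ∘ <⇒≢ ∘ ∈-upTo⁻)
    none-after : count (_≡ᵇ j) (between j (suc n)) ≡ 0
    none-after = count-none (_≡ᵇ j) (between j (suc n)) (≡ᵇ-false ∘ >⇒≢ ∘ proj₁ ∘ ∈-between⁻ {y = suc n})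

  ∑-shifted-product : ∀ (ks : List ℕ) (d e : ℕ → ℕ) a b →
    ∑[ k ∈ ks ] ((d k + a) * (e k + b)) ≡ ∑[ k ∈ ks ] (d k * e k) + (∑ ks d * b + (a * ∑ ks e + length ks * (a * b)))
  ∑-shifted-product []       d e a b = sym (cong (_+ 0) (*-zeroʳ a))
  ∑-shifted-product (k ∷ ks) d e a b rewrite ∑-shifted-product ks d e a b =
    solve 8 (λ dk ek a b Σde Σd Σe ℓ →
               (dk :+ a) :* (ek :+ b) :+ (Σde :+ (Σd :* b :+ (a :* Σe :+ ℓ :* (a :* b))))
            := dk :* ek :+ Σde :+ ((dk :+ Σd) :* b :+ (a :* (ek :+ Σe) :+ (con 1 :+ ℓ) :* (a :* b))))
            refl (d k) (e k) a b (∑[ k ∈ ks ] (d k * e k)) (∑ ks d) (∑ ks e) (length ks)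

  𝟙≡ᵇ-* : ∀ k i j → 𝟙 (k ≡ᵇ i) * 𝟙 (k ≡ᵇ j) ≡ 𝟙 (i ≡ᵇ j) * 𝟙 (k ≡ᵇ i)
  𝟙≡ᵇ-* k i j with k ≟ i
  ... | yes refl rewrite ≡ᵇ-refl k = *-comm 1 (𝟙 (k ≡ᵇ j))
  ... | no  k≢i  rewrite ≡ᵇ-false k≢i = sym (*-zeroʳ (𝟙 (i ≡ᵇ j)))

  private
    position≤n : k ∈ upTo (suc n) → k ≤ n
    position≤n = ≤-pred ∘ ∈-upTo⁻

  ∑-perms-jump : ∀ {F n j} → JumpsAt F n j → ∑[ σ ∈ perms (suc n) ] F σ ≡ suc n * ∑[ τ ∈ perms n ] F τ + ∑[ τ ∈ perms n ] 1
  ∑-perms-jump {F} {n} {j} F-jumps = ∑-perms-step n F (λ _ → 1) (λ {τ} τ∈ → begin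
    ∑[ k ∈ positions ] F (insertAtℕ τ k n)                   ≡⟨ ∑-cong positions (jump τ∈ ∘ position≤n) ⟩
    ∑[ k ∈ positions ] (𝟙 (k ≡ᵇ j) + F τ)                    ≡⟨ ∑-+ positions (λ k → 𝟙 (k ≡ᵇ j)) (λ _ → F τ) ⟩
    ∑[ k ∈ positions ] 𝟙 (k ≡ᵇ j) + ∑[ k ∈ positions ] F τ  ≡⟨ cong₂ _+_ (∑-𝟙≡ᵇ j≤n) (∑-const positions (F τ)) ⟩
    1 + length positions * F τ                               ≡⟨ cong (λ m → 1 + m * F τ) (length-upTo (suc n)) ⟩
    1 + suc n * F τ                                          ≡⟨ +-comm 1 _ ⟩
    suc n * F τ + 1                                          ∎)
    where
    open ≡-Reasoning
    open JumpsAt F-jumps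
    positions : List ℕ
    positions = upTo (suc n)

  ∑-perms-jump-product : ∀ {F G n i j} → JumpsAt F n i → JumpsAt G n j →
    ∑[ σ ∈ perms (suc n) ] (F σ * G σ) ≡ suc n * ∑[ τ ∈ perms n ] (F τ * G τ) + ∑[ τ ∈ perms n ] (𝟙 (i ≡ᵇ j) + F τ + G τ)
  ∑-perms-jump-product {F} {G} {n} {i} {j} F-jumps G-jumps =
    ∑-perms-step n (λ σ → F σ * G σ) (λ τ → 𝟙 (i ≡ᵇ j) + F τ + G τ) (λ {τ} τ∈ → begin
    ∑[ k ∈ positions ] (F (insertAtℕ τ k n) * G (insertAtℕ τ k n))
      ≡⟨ ∑-cong positions (λ k∈ → cong₂ _*_ (F.jump τ∈ (position≤n k∈)) (G.jump τ∈ (position≤n k∈))) ⟩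
    ∑[ k ∈ positions ] ((𝟙 (k ≡ᵇ i) + F τ) * (𝟙 (k ≡ᵇ j) + G τ))
      ≡⟨ ∑-shifted-product positions (λ k → 𝟙 (k ≡ᵇ i)) (λ k → 𝟙 (k ≡ᵇ j)) (F τ) (G τ) ⟩
    ∑[ k ∈ positions ] (𝟙 (k ≡ᵇ i) * 𝟙 (k ≡ᵇ j))
      + (∑[ k ∈ positions ] 𝟙 (k ≡ᵇ i) * G τ + (F τ * ∑[ k ∈ positions ] 𝟙 (k ≡ᵇ j) + length positions * (F τ * G τ)))
      ≡⟨ cong₂ (λ c sᵢ → c + (sᵢ * G τ + (F τ * ∑[ k ∈ positions ] 𝟙 (k ≡ᵇ j) + length positions * (F τ * G τ))))
               coincide (∑-𝟙≡ᵇ F.j≤n) ⟩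
    𝟙 (i ≡ᵇ j) + (1 * G τ + (F τ * ∑[ k ∈ positions ] 𝟙 (k ≡ᵇ j) + length positions * (F τ * G τ)))
      ≡⟨ cong₂ (λ sⱼ m → 𝟙 (i ≡ᵇ j) + (1 * G τ + (F τ * sⱼ + m * (F τ * G τ)))) (∑-𝟙≡ᵇ G.j≤n) (length-upTo (suc n)) ⟩
    𝟙 (i ≡ᵇ j) + (1 * G τ + (F τ * 1 + suc n * (F τ * G τ)))
      ≡⟨ solve 4 (λ c f g m → c :+ (con 1 :* g :+ (f :* con 1 :+ m :* (f :* g))) := m :* (f :* g) :+ (c :+ f :+ g))
                 refl (𝟙 (i ≡ᵇ j)) (F τ) (G τ) (suc n) ⟩
    suc n * (F τ * G τ) + (𝟙 (i ≡ᵇ j) + F τ + G τ) ∎)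
    where
    open ≡-Reasoning
    module F = JumpsAt F-jumps
    module G = JumpsAt G-jumps
    positions : List ℕ
    positions = upTo (suc n)
    coincide : ∑[ k ∈ positions ] (𝟙 (k ≡ᵇ i) * 𝟙 (k ≡ᵇ j)) ≡ 𝟙 (i ≡ᵇ j)
    coincide = begin
      ∑[ k ∈ positions ] (𝟙 (k ≡ᵇ i) * 𝟙 (k ≡ᵇ j))  ≡⟨ ∑-cong positions (λ {k} _ → 𝟙≡ᵇ-* k i j) ⟩
      ∑[ k ∈ positions ] (𝟙 (i ≡ᵇ j) * 𝟙 (k ≡ᵇ i))  ≡⟨ ∑-*ˡ (𝟙 (i ≡ᵇ j)) positions _ ⟩
      𝟙 (i ≡ᵇ j) * ∑[ k ∈ positions ] 𝟙 (k ≡ᵇ i)    ≡⟨ cong (𝟙 (i ≡ᵇ j) *_) (∑-𝟙≡ᵇ F.j≤n) ⟩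
      𝟙 (i ≡ᵇ j) * 1                                ≡⟨ *-identityʳ _ ⟩
      𝟙 (i ≡ᵇ j)                                    ∎

module Moments where

  open import Data.Integer as ℤ using (1ℤ)
  import Data.Integer.Properties as ℤₚ
  open import Data.List using (List; []; _∷_; length; map)
  open import Data.List.Membership.Propositional using (_∈_)
  open import Data.List.Relation.Unary.Any using (here; there)
  open import Data.List.Properties using (length-map)
  open import Data.Nat as ℕ using (ℕ; zero; suc; _!; _≡ᵇ_)
  import Data.Nat.Properties as ℕ
  import Data.Nat.Coprimality as Coprime
  open import Data.Product using (_,_)
  open import Data.Rational using (ℚ; mkℚ; _/_; 0ℚ; 1ℚ; _+_; _*_; _-_; -_; _≤_; ∣_∣; NonNegative)
  open import Data.Rational.Properties
    using ( normalize-coprime; normalize-nonNeg; /-cong; *-inverseʳ; nonNegative⁻¹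
          ; +-identityˡ; +-identityʳ; *-identityˡ; *-identityʳ; *-zeroˡ; *-zeroʳ; *-assoc; *-distribˡ-+; *-distribʳ-+
          ; +-assoc; nonNeg*nonNeg⇒nonNeg; ≤-refl; +-mono-≤; +-monoˡ-≤; +-monoʳ-≤; *-monoʳ-≤-nonNeg; *-monoˡ-≤-nonNeg
          ; 0≤p⇒∣p∣≡p; ∣p-q∣≤∣p∣+∣q∣; ∣p*q∣≡∣p∣*∣q∣; ≤ᵇ⇒≤; module ≤-Reasoning )
  open import Data.Rational.Solver using (module +-*-Solver)
  open +-*-Solver using (solve; _:+_; _:*_; _:-_; :-_; _:=_; con)
  open import Function using (_∘_)
  open import Relation.Binary.PropositionalEquality
  open Combinatorics
    using (𝟙; ∑; ≡ᵇ-refl; JumpsAt; L-jumps; R-jumps; ∑-perms-jump; ∑-perms-jump-product; length-perms; S+2≡L+R)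

  private variable
    A : Set

  -- `1/ℕ 0 = 0` is a junk value.
  1/ℕ : ℕ → ℚ
  1/ℕ zero    = 0ℚ
  1/ℕ (suc n) = 1ℤ / suc n

  private
    normal : ℕ → ℚ
    normal n = mkℚ (ℤ.+ n) 0 (Coprime.sym (Coprime.1-coprimeTo n))

    fromℕ≡normal : ∀ n → fromℕ n ≡ normal n
    fromℕ≡normal n = normalize-coprime (Coprime.sym (Coprime.1-coprimeTo n))

  fromℕ-+ : ∀ m n → fromℕ (m ℕ.+ n) ≡ fromℕ m + fromℕ n
  fromℕ-+ m n = begin
    fromℕ (m ℕ.+ n)      ≡⟨ /-cong (cong₂ ℤ._+_ (ℤₚ.*-identityʳ (ℤ.+ m)) (ℤₚ.*-identityʳ (ℤ.+ n))) refl ⟨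
    normal m + normal n  ≡⟨ cong₂ _+_ (fromℕ≡normal m) (fromℕ≡normal n) ⟨
    fromℕ m + fromℕ n    ∎
    where open ≡-Reasoning

  fromℕ-* : ∀ m n → fromℕ (m ℕ.* n) ≡ fromℕ m * fromℕ n
  fromℕ-* m n = begin
    fromℕ (m ℕ.* n)      ≡⟨ /-cong (sym (ℤₚ.pos-* m n)) refl ⟨
    normal m * normal n  ≡⟨ cong₂ _*_ (fromℕ≡normal m) (fromℕ≡normal n) ⟨
    fromℕ m * fromℕ n    ∎
    where open ≡-Reasoning

  fromℕ*1/ℕ : ∀ n .{{_ : ℕ.NonZero n}} → fromℕ n * 1/ℕ n ≡ 1ℚ
  fromℕ*1/ℕ (suc n) rewrite fromℕ≡normal (suc n) | normalize-coprime (Coprime.1-coprimeTo (suc n)) =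
    *-inverseʳ (normal (suc n))

  inverse-unique : ∀ {p x y} → p * x ≡ 1ℚ → p * y ≡ 1ℚ → x ≡ y
  inverse-unique {p} {x} {y} px≡1 py≡1 = begin
    x              ≡⟨ *-identityʳ x ⟨
    x * 1ℚ         ≡⟨ cong (x *_) py≡1 ⟨
    x * (p * y)    ≡⟨ solve 3 (λ p x y → x :* (p :* y) := (p :* x) :* y) refl p x y ⟩
    (p * x) * y    ≡⟨ cong (_* y) px≡1 ⟩
    1ℚ * y         ≡⟨ *-identityˡ y ⟩
    y              ∎
    where open ≡-Reasoning

  1/ℕ-* : ∀ m n → 1/ℕ (m ℕ.* n) ≡ 1/ℕ m * 1/ℕ n
  1/ℕ-* zero    n       = sym (*-zeroˡ (1/ℕ n))
  1/ℕ-* (suc m) zero    rewrite ℕ.*-zeroʳ m = sym (*-zeroʳ (1/ℕ (suc m)))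
  1/ℕ-* (suc m) (suc n) = inverse-unique {p = fromℕ (suc m ℕ.* suc n)} (fromℕ*1/ℕ (suc m ℕ.* suc n)) (begin
    fromℕ (suc m ℕ.* suc n) * (u * v)  ≡⟨ cong (_* (u * v)) (fromℕ-* (suc m) (suc n)) ⟩
    fromℕ (suc m) * fromℕ (suc n) * (u * v)
                                       ≡⟨ solve 4 (λ a b u v → a :* b :* (u :* v) := (a :* u) :* (b :* v)) refl (fromℕ (suc m)) (fromℕ (suc n)) u v ⟩
    (fromℕ (suc m) * u) * (fromℕ (suc n) * v)
                                       ≡⟨ cong₂ _*_ (fromℕ*1/ℕ (suc m)) (fromℕ*1/ℕ (suc n)) ⟩
    1ℚ                                 ∎)
    where
    open ≡-Reasoning
    u v : ℚ
    u = 1/ℕ (suc m)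
    v = 1/ℕ (suc n)

  1/ℕ-nonNeg : ∀ n → NonNegative (1/ℕ n)
  1/ℕ-nonNeg zero    = _
  1/ℕ-nonNeg (suc n) = normalize-nonNeg 1 (suc n)

  ℚsum-+ : ∀ (xs : List A) f g → ℚsum (map (λ a → f a + g a) xs) ≡ ℚsum (map f xs) + ℚsum (map g xs)
  ℚsum-+ []       f g = refl
  ℚsum-+ (a ∷ xs) f g rewrite ℚsum-+ xs f g =
    solve 4 (λ p q r s → (p :+ q) :+ (r :+ s) := (p :+ r) :+ (q :+ s)) refl (f a) (g a) (ℚsum (map f xs)) (ℚsum (map g xs))

  ℚsum-*ˡ : ∀ c (xs : List A) f → ℚsum (map (λ a → c * f a) xs) ≡ c * ℚsum (map f xs)
  ℚsum-*ˡ c []       f = sym (*-zeroʳ c)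
  ℚsum-*ˡ c (a ∷ xs) f = trans (cong (c * f a +_) (ℚsum-*ˡ c xs f)) (sym (*-distribˡ-+ c (f a) _))

  ℚsum-const : ∀ (xs : List A) c → ℚsum (map (λ _ → c) xs) ≡ fromℕ (length xs) * c
  ℚsum-const []       c = sym (*-zeroˡ c)
  ℚsum-const (a ∷ xs) c = begin
    c + ℚsum (map (λ _ → c) xs)      ≡⟨ cong (c +_) (ℚsum-const xs c) ⟩
    c + fromℕ (length xs) * c        ≡⟨ solve 2 (λ c ℓ → c :+ ℓ :* c := (con 1ℚ :+ ℓ) :* c) refl c (fromℕ (length xs)) ⟩
    (1ℚ + fromℕ (length xs)) * c     ≡⟨ cong (_* c) (fromℕ-+ 1 (length xs)) ⟨
    fromℕ (suc (length xs)) * c      ∎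
    where open ≡-Reasoning

  ℚsum-cong : ∀ (xs : List A) {f g} → (∀ {a} → a ∈ xs → f a ≡ g a) → ℚsum (map f xs) ≡ ℚsum (map g xs)
  ℚsum-cong []       _ = refl
  ℚsum-cong (a ∷ xs) h = cong₂ _+_ (h (here refl)) (ℚsum-cong xs (h ∘ there))

  ℚsum-fromℕ : ∀ (xs : List A) g → ℚsum (map (λ a → fromℕ (g a)) xs) ≡ fromℕ (∑ xs g)
  ℚsum-fromℕ []       g = refl
  ℚsum-fromℕ (a ∷ xs) g = trans (cong (fromℕ (g a) +_) (ℚsum-fromℕ xs g)) (sym (fromℕ-+ (g a) (∑ xs g)))

  mean≡ℚsum*1/length : ∀ (qs : List ℚ) → mean qs ≡ ℚsum qs * 1/ℕ (length qs)
  mean≡ℚsum*1/length []       = refl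
  mean≡ℚsum*1/length (q ∷ qs) = refl

  E≡ℚsum*1/n! : ∀ n f → E n f ≡ ℚsum (map f (perms n)) * 1/ℕ (n !)
  E≡ℚsum*1/n! n f = trans (mean≡ℚsum*1/length (map f (perms n)))
    (cong (λ m → ℚsum (map f (perms n)) * 1/ℕ m) (trans (length-map f (perms n)) (length-perms n)))

  ↑_ : (List ℕ → ℕ) → List ℕ → ℚ
  (↑ F) τ = fromℕ (F τ)

  module _ (n : ℕ) where

    E-cong : ∀ {f g} → (∀ {τ} → τ ∈ perms n → f τ ≡ g τ) → E n f ≡ E n g
    E-cong {f} {g} h rewrite E≡ℚsum*1/n! n f | E≡ℚsum*1/n! n g = cong (_* 1/ℕ (n !)) (ℚsum-cong (perms n) h)

    E-+ : ∀ f g → E n (λ τ → f τ + g τ) ≡ E n f + E n g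
    E-+ f g rewrite E≡ℚsum*1/n! n (λ τ → f τ + g τ) | E≡ℚsum*1/n! n f | E≡ℚsum*1/n! n g | ℚsum-+ (perms n) f g =
      *-distribʳ-+ (1/ℕ (n !)) (ℚsum (map f (perms n))) _

    E-*ˡ : ∀ c f → E n (λ τ → c * f τ) ≡ c * E n f
    E-*ˡ c f rewrite E≡ℚsum*1/n! n (λ τ → c * f τ) | E≡ℚsum*1/n! n f | ℚsum-*ˡ c (perms n) f =
      *-assoc c (ℚsum (map f (perms n))) _

    E-const : ∀ c → E n (λ _ → c) ≡ c
    E-const c rewrite E≡ℚsum*1/n! n (λ _ → c) | ℚsum-const (perms n) c | length-perms n = begin
      fromℕ (n !) * c * 1/ℕ (n !)      ≡⟨ solve 3 (λ a c u → a :* c :* u := (a :* u) :* c) refl (fromℕ (n !)) c (1/ℕ (n !)) ⟩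
      fromℕ (n !) * 1/ℕ (n !) * c      ≡⟨ cong (_* c) (fromℕ*1/ℕ (n !) {{ℕ._!≢0 n}}) ⟩
      1ℚ * c                           ≡⟨ *-identityˡ c ⟩
      c                                ∎
      where open ≡-Reasoning

    E-↑ : ∀ g → E n (↑ g) ≡ fromℕ (∑ (perms n) g) * 1/ℕ (n !)
    E-↑ g = trans (E≡ℚsum*1/n! n (↑ g)) (cong (_* 1/ℕ (n !)) (ℚsum-fromℕ (perms n) g))

  E-step : ∀ n g h → ∑ (perms (suc n)) g ≡ suc n ℕ.* ∑ (perms n) g ℕ.+ ∑ (perms n) h →
           E (suc n) (↑ g) ≡ E n (↑ g) + E n (↑ h) * 1/ℕ (suc n)
  E-step n g h sum-step = begin
    E (suc n) (↑ g)                              ≡⟨ E-↑ (suc n) g ⟩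
    fromℕ (∑ (perms (suc n)) g) * 1/ℕ (suc n !)  ≡⟨ cong₂ (λ m v → fromℕ m * v) sum-step (1/ℕ-* (suc n) (n !)) ⟩
    fromℕ (suc n ℕ.* Tg ℕ.+ Th) * (u * i)        ≡⟨ cong (_* (u * i)) (trans (fromℕ-+ (suc n ℕ.* Tg) Th) (cong (_+ Σh) (fromℕ-* (suc n) Tg))) ⟩
    (a * Σg + Σh) * (u * i)                      ≡⟨ solve 5 (λ a Σg Σh u i → (a :* Σg :+ Σh) :* (u :* i) := Σg :* i :* (a :* u) :+ Σh :* i :* u)
                                                      refl a Σg Σh u i ⟩
    Σg * i * (a * u) + Σh * i * u                ≡⟨ cong (λ x → Σg * i * x + Σh * i * u) (fromℕ*1/ℕ (suc n)) ⟩
    Σg * i * 1ℚ + Σh * i * u                     ≡⟨ cong (_+ Σh * i * u) (*-identityʳ (Σg * i)) ⟩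
    Σg * i + Σh * i * u                          ≡⟨ cong₂ (λ x y → x + y * u) (E-↑ n g) (E-↑ n h) ⟨
    E n (↑ g) + E n (↑ h) * u                    ∎
    where
    open ≡-Reasoning
    Tg Th : ℕ
    Tg = ∑ (perms n) g
    Th = ∑ (perms n) h
    a Σg Σh u i : ℚ
    a = fromℕ (suc n)
    Σg = fromℕ Tg
    Σh = fromℕ Th
    u = 1/ℕ (suc n)
    i = 1/ℕ (n !)

  Cov≡E[fg]-E[f]E[g] : ∀ n f g → Cov n f g ≡ E n (λ τ → f τ * g τ) - E n f * E n g
  Cov≡E[fg]-E[f]E[g] n f g = begin
    E n (λ τ → (f τ - a) * (g τ - b))
      ≡⟨ E-cong n (λ {τ} _ → solve 4 (λ x y a b → (x :- a) :* (y :- b) := x :* y :+ ((:- b) :* x :+ (:- a) :* y) :+ a :* b)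
                                     refl (f τ) (g τ) a b) ⟩
    E n (λ τ → f τ * g τ + ((- b) * f τ + (- a) * g τ) + a * b)
      ≡⟨ E-+ n _ (λ _ → a * b) ⟩
    E n (λ τ → f τ * g τ + ((- b) * f τ + (- a) * g τ)) + E n (λ _ → a * b)
      ≡⟨ cong₂ _+_ (E-+ n (λ τ → f τ * g τ) _) (E-const n (a * b)) ⟩
    E n (λ τ → f τ * g τ) + E n (λ τ → (- b) * f τ + (- a) * g τ) + a * b
      ≡⟨ cong (λ e → E n (λ τ → f τ * g τ) + e + a * b) (trans (E-+ n _ _) (cong₂ _+_ (E-*ˡ n (- b) f) (E-*ˡ n (- a) g))) ⟩
    E n (λ τ → f τ * g τ) + ((- b) * a + (- a) * b) + a * b
      ≡⟨ solve 3 (λ e a b → e :+ ((:- b) :* a :+ (:- a) :* b) :+ a :* b := e :- a :* b) refl (E n (λ τ → f τ * g τ)) a b ⟩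
    E n (λ τ → f τ * g τ) - a * b
      ∎
    where
    open ≡-Reasoning
    a b : ℚ
    a = E n f
    b = E n g

  E-jump : ∀ {F n j} → JumpsAt F n j → E (suc n) (↑ F) ≡ E n (↑ F) + 1/ℕ (suc n)
  E-jump {F} {n} F-jumps = begin
    E (suc n) (↑ F)                              ≡⟨ E-step n F (λ _ → 1) (∑-perms-jump F-jumps) ⟩
    E n (↑ F) + E n (λ _ → 1ℚ) * 1/ℕ (suc n)     ≡⟨ cong (λ e → E n (↑ F) + e * 1/ℕ (suc n)) (E-const n 1ℚ) ⟩
    E n (↑ F) + 1ℚ * 1/ℕ (suc n)                 ≡⟨ cong (E n (↑ F) +_) (*-identityˡ (1/ℕ (suc n))) ⟩
    E n (↑ F) + 1/ℕ (suc n)                      ∎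
    where open ≡-Reasoning

  module _ {F G : List ℕ → ℕ} {n i j : ℕ} where

    E-jump-product : JumpsAt F n i → JumpsAt G n j →
      E (suc n) (↑ (λ σ → F σ ℕ.* G σ)) ≡
      E n (↑ (λ τ → F τ ℕ.* G τ)) + (fromℕ (𝟙 (i ≡ᵇ j)) + E n (↑ F) + E n (↑ G)) * 1/ℕ (suc n)
    E-jump-product F-jumps G-jumps = trans (E-step n _ _ (∑-perms-jump-product F-jumps G-jumps))
      (cong (λ e → E n (↑ (λ τ → F τ ℕ.* G τ)) + e * 1/ℕ (suc n)) (begin
        E n (↑ (λ τ → 𝟙 (i ≡ᵇ j) ℕ.+ F τ ℕ.+ G τ))
          ≡⟨ E-cong n (λ {τ} _ → trans (fromℕ-+ (𝟙 (i ≡ᵇ j) ℕ.+ F τ) (G τ))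
                                        (cong (_+ fromℕ (G τ)) (fromℕ-+ (𝟙 (i ≡ᵇ j)) (F τ)))) ⟩
        E n (λ τ → fromℕ (𝟙 (i ≡ᵇ j)) + fromℕ (F τ) + fromℕ (G τ))
          ≡⟨ trans (E-+ n _ (↑ G)) (cong (_+ E n (↑ G)) (E-+ n _ (↑ F))) ⟩
        E n (λ _ → fromℕ (𝟙 (i ≡ᵇ j))) + E n (↑ F) + E n (↑ G)
          ≡⟨ cong (λ c → c + E n (↑ F) + E n (↑ G)) (E-const n _) ⟩
        fromℕ (𝟙 (i ≡ᵇ j)) + E n (↑ F) + E n (↑ G) ∎))
      where open ≡-Reasoning

    -- With u = 1/(n+1): E F and E G grow by u, and E (F G) by (c + E F + E G) u, so Cov grows by (c - u) u.
    Cov-jump : JumpsAt F n i → JumpsAt G n j →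
      Cov (suc n) (↑ F) (↑ G) ≡ Cov n (↑ F) (↑ G) + (fromℕ (𝟙 (i ≡ᵇ j)) - 1/ℕ (suc n)) * 1/ℕ (suc n)
    Cov-jump F-jumps G-jumps = begin
      Cov (suc n) (↑ F) (↑ G)
        ≡⟨ Cov≡E[fg]-E[f]E[g] (suc n) (↑ F) (↑ G) ⟩
      E (suc n) (λ σ → fromℕ (F σ) * fromℕ (G σ)) - E (suc n) (↑ F) * E (suc n) (↑ G)
        ≡⟨ cong₂ (λ m p → m - p) (trans (E[↑F*↑G] (suc n)) (E-jump-product F-jumps G-jumps))
                                 (cong₂ _*_ (E-jump F-jumps) (E-jump G-jumps)) ⟩
      E[FG] + (c + EF + EG) * u - (EF + u) * (EG + u)
        ≡⟨ solve 5 (λ m c f g u → m :+ (c :+ f :+ g) :* u :- (f :+ u) :* (g :+ u) := m :- f :* g :+ (c :- u) :* u)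
                   refl E[FG] c EF EG u ⟩
      E[FG] - EF * EG + (c - u) * u
        ≡⟨ cong (λ m → m - EF * EG + (c - u) * u) (E[↑F*↑G] n) ⟨
      E n (λ τ → fromℕ (F τ) * fromℕ (G τ)) - EF * EG + (c - u) * u
        ≡⟨ cong (_+ (c - u) * u) (Cov≡E[fg]-E[f]E[g] n (↑ F) (↑ G)) ⟨
      Cov n (↑ F) (↑ G) + (c - u) * u
        ∎
      where
      open ≡-Reasoning
      E[↑F*↑G] : ∀ m → E m (λ σ → fromℕ (F σ) * fromℕ (G σ)) ≡ E m (↑ (λ σ → F σ ℕ.* G σ))
      E[↑F*↑G] m = E-cong m (λ {σ} _ → sym (fromℕ-* (F σ) (G σ)))
      E[FG] EF EG c u : ℚ
      E[FG] = E n (↑ (λ τ → F τ ℕ.* G τ))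
      EF = E n (↑ F)
      EG = E n (↑ G)
      c = fromℕ (𝟙 (i ≡ᵇ j))
      u = 1/ℕ (suc n)

  -- Moments of L, R and S

  module _ {F : List ℕ → ℕ} {pos : ℕ → ℕ} (F-jumps : ∀ n → JumpsAt F n (pos n)) (F[]≡0 : F [] ≡ 0) where

    E≡H : ∀ n → E n (↑ F) ≡ H n
    E≡H zero    rewrite F[]≡0 = refl
    E≡H (suc n) = trans (E-jump (F-jumps n)) (cong (_+ 1/ℕ (suc n)) (E≡H n))

    Var≡H-H2 : ∀ n → Var n (↑ F) ≡ H n - H2 n
    Var≡H-H2 zero    rewrite F[]≡0 = refl
    Var≡H-H2 (suc n) = begin
      Cov (suc n) (↑ F) (↑ F)
        ≡⟨ Cov-jump (F-jumps n) (F-jumps n) ⟩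
      Var n (↑ F) + (fromℕ (𝟙 (pos n ≡ᵇ pos n)) - u) * u
        ≡⟨ cong₂ (λ v b → v + (fromℕ (𝟙 b) - u) * u) (Var≡H-H2 n) (≡ᵇ-refl (pos n)) ⟩
      H n - H2 n + (1ℚ - u) * u
        ≡⟨ solve 3 (λ h h₂ u → h :- h₂ :+ (con 1ℚ :- u) :* u := h :+ u :- (h₂ :+ u :* u)) refl (H n) (H2 n) u ⟩
      H n + u - (H2 n + u * u)
        ≡⟨ cong (λ v → H n + u - (H2 n + v)) (1/ℕ-* (suc n) (suc n)) ⟨
      H (suc n) - H2 (suc n)
        ∎
      where
      open ≡-Reasoning
      u : ℚ
      u = 1/ℕ (suc n)

  E-L : ∀ n → E n (↑ L) ≡ H n
  E-L = E≡H L-jumps refl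

  E-R : ∀ n → E n (↑ R) ≡ H n
  E-R = E≡H R-jumps refl

  Var-L : ∀ n → Var n (↑ L) ≡ H n - H2 n
  Var-L = Var≡H-H2 L-jumps refl

  Var-R : ∀ n → Var n (↑ R) ≡ H n - H2 n
  Var-R = Var≡H-H2 R-jumps refl

  Cov-L-R : ∀ n → Cov (suc n) (↑ L) (↑ R) ≡ 1ℚ - H2 (suc n)
  Cov-L-R zero    = refl
  Cov-L-R (suc n) = begin
    Cov (suc (suc n)) (↑ L) (↑ R)                   ≡⟨ Cov-jump (L-jumps (suc n)) (R-jumps (suc n)) ⟩
    Cov (suc n) (↑ L) (↑ R) + (0ℚ - u) * u          ≡⟨ cong (_+ (0ℚ - u) * u) (Cov-L-R n) ⟩
    1ℚ - H2 (suc n) + (0ℚ - u) * u                  ≡⟨ solve 2 (λ h₂ u → con 1ℚ :- h₂ :+ (con 0ℚ :- u) :* u := con 1ℚ :- (h₂ :+ u :* u))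
                                                          refl (H2 (suc n)) u ⟩
    1ℚ - (H2 (suc n) + u * u)                       ≡⟨ cong (λ v → 1ℚ - (H2 (suc n) + v)) (1/ℕ-* (suc (suc n)) (suc (suc n))) ⟨
    1ℚ - H2 (suc (suc n))                           ∎
    where
    open ≡-Reasoning
    u : ℚ
    u = 1/ℕ (suc (suc n))

  module _ (n : ℕ) {s : List ℕ → ℚ} (f g : List ℕ → ℚ) (c : ℚ) (s≡f+g+c : ∀ {τ} → τ ∈ perms n → s τ ≡ f τ + g τ + c) where

    E-sum : E n s ≡ E n f + E n g + c
    E-sum = begin
      E n s                                ≡⟨ E-cong n s≡f+g+c ⟩
      E n (λ τ → f τ + g τ + c)            ≡⟨ E-+ n (λ τ → f τ + g τ) (λ _ → c) ⟩
      E n (λ τ → f τ + g τ) + E n (λ _ → c) ≡⟨ cong₂ _+_ (E-+ n f g) (E-const n c) ⟩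
      E n f + E n g + c                    ∎
      where open ≡-Reasoning

    Var-sum : Var n s ≡ Var n f + Var n g + fromℕ 2 * Cov n f g
    Var-sum = begin
      E n (λ τ → (s τ - E n s) * (s τ - E n s))
        ≡⟨ E-cong n (λ {τ} τ∈ → cong₂ (λ x y → (x - y) * (x - y)) (s≡f+g+c τ∈) E-sum) ⟩
      E n (λ τ → (f τ + g τ + c - (E n f + E n g + c)) * (f τ + g τ + c - (E n f + E n g + c)))
        ≡⟨ E-cong n (λ {τ} _ → solve 5 (λ x y a b c →
             (x :+ y :+ c :- (a :+ b :+ c)) :* (x :+ y :+ c :- (a :+ b :+ c))
               := (x :- a) :* (x :- a) :+ (y :- b) :* (y :- b) :+ con (fromℕ 2) :* ((x :- a) :* (y :- b)))
             refl (f τ) (g τ) (E n f) (E n g) c) ⟩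
      E n (λ τ → (f τ - E n f) * (f τ - E n f) + (g τ - E n g) * (g τ - E n g) + fromℕ 2 * ((f τ - E n f) * (g τ - E n g)))
        ≡⟨ E-+ n _ _ ⟩
      E n (λ τ → (f τ - E n f) * (f τ - E n f) + (g τ - E n g) * (g τ - E n g)) + E n (λ τ → fromℕ 2 * ((f τ - E n f) * (g τ - E n g)))
        ≡⟨ cong₂ _+_ (E-+ n _ _) (E-*ˡ n (fromℕ 2) _) ⟩
      Var n f + Var n g + fromℕ 2 * Cov n f g
        ∎
      where open ≡-Reasoning

  ↑S≡↑L+↑R-2 : ∀ n {τ} → τ ∈ perms (suc n) → (↑ S) τ ≡ (↑ L) τ + (↑ R) τ + - fromℕ 2
  ↑S≡↑L+↑R-2 n {τ} τ∈ = begin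
    fromℕ (S τ)                                  ≡⟨ solve 2 (λ x t → x := x :+ t :- t) refl (fromℕ (S τ)) (fromℕ 2) ⟩
    fromℕ (S τ) + fromℕ 2 - fromℕ 2              ≡⟨ cong (_- fromℕ 2) (fromℕ-+ (S τ) 2) ⟨
    fromℕ (S τ ℕ.+ 2) - fromℕ 2                  ≡⟨ cong (λ m → fromℕ m - fromℕ 2) (S+2≡L+R n τ∈) ⟩
    fromℕ (L τ ℕ.+ R τ) - fromℕ 2                ≡⟨ cong (_- fromℕ 2) (fromℕ-+ (L τ) (R τ)) ⟩
    fromℕ (L τ) + fromℕ (R τ) - fromℕ 2          ∎
    where open ≡-Reasoning

  E-S : ∀ n → E (suc n) (↑ S) ≡ fromℕ 2 * H (suc n) - fromℕ 2
  E-S n = begin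
    E (suc n) (↑ S)                              ≡⟨ E-sum (suc n) (↑ L) (↑ R) (- fromℕ 2) (↑S≡↑L+↑R-2 n) ⟩
    E (suc n) (↑ L) + E (suc n) (↑ R) - fromℕ 2  ≡⟨ cong₂ (λ a b → a + b - fromℕ 2) (E-L (suc n)) (E-R (suc n)) ⟩
    H (suc n) + H (suc n) - fromℕ 2              ≡⟨ solve 1 (λ h → h :+ h :- con (fromℕ 2) := con (fromℕ 2) :* h :- con (fromℕ 2)) refl (H (suc n)) ⟩
    fromℕ 2 * H (suc n) - fromℕ 2                ∎
    where open ≡-Reasoning

  Var-S : ∀ n → Var (suc n) (↑ S) ≡ fromℕ 2 * (H (suc n) - H2 (suc n)) + fromℕ 2 * Cov (suc n) (↑ L) (↑ R)
  Var-S n = begin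
    Var (suc n) (↑ S)                        ≡⟨ Var-sum (suc n) (↑ L) (↑ R) (- fromℕ 2) (↑S≡↑L+↑R-2 n) ⟩
    Var (suc n) (↑ L) + Var (suc n) (↑ R) + 2c ≡⟨ cong₂ (λ a b → a + b + 2c) (Var-L (suc n)) (Var-R (suc n)) ⟩
    v + v + 2c                               ≡⟨ cong (_+ 2c) (solve 1 (λ v → v :+ v := con (fromℕ 2) :* v) refl v) ⟩
    fromℕ 2 * v + 2c                         ∎
    where
    open ≡-Reasoning
    v 2c : ℚ
    v = H (suc n) - H2 (suc n)
    2c = fromℕ 2 * Cov (suc n) (↑ L) (↑ R)

  Var[S]-2H≡2-4H2 : ∀ n → Var (suc n) (↑ S) - fromℕ 2 * H (suc n) ≡ fromℕ 2 - fromℕ 4 * H2 (suc n)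
  Var[S]-2H≡2-4H2 n = begin
    Var (suc n) (↑ S) - two * h                                ≡⟨ cong (_- two * h) (Var-S n) ⟩
    two * (h - h₂) + two * Cov (suc n) (↑ L) (↑ R) - two * h   ≡⟨ cong (λ c → two * (h - h₂) + two * c - two * h) (Cov-L-R n) ⟩
    two * (h - h₂) + two * (1ℚ - h₂) - two * h                 ≡⟨ solve 2 (λ h h₂ → con two :* (h :- h₂) :+ con two :* (con 1ℚ :- h₂) :- con two :* h
                                                                                 := con two :- con (fromℕ 4) :* h₂) refl h h₂ ⟩
    two - fromℕ 4 * h₂                                         ∎
    where
    open ≡-Reasoning
    two h h₂ : ℚ
    two = fromℕ 2
    h = H (suc n)
    h₂ = H2 (suc n)

  H2-nonNeg : ∀ n → 0ℚ ≤ H2 n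
  H2-nonNeg zero    = ≤-refl
  H2-nonNeg (suc n) = +-mono-≤ (H2-nonNeg n) (nonNegative⁻¹ (1/ℕ (suc n ℕ.* suc n)) {{1/ℕ-nonNeg (suc n ℕ.* suc n)}})

  1/ℕ-split : ∀ n → 1/ℕ (suc n) ≡ 1/ℕ (suc n) * 1/ℕ (suc (suc n)) + 1/ℕ (suc (suc n))
  1/ℕ-split n = begin
    a                                  ≡⟨ *-identityʳ a ⟨
    a * 1ℚ                             ≡⟨ cong (a *_) (fromℕ*1/ℕ (suc (suc n))) ⟨
    a * (fromℕ (1 ℕ.+ suc n) * b)      ≡⟨ cong (λ x → a * (x * b)) (fromℕ-+ 1 (suc n)) ⟩
    a * ((1ℚ + fromℕ (suc n)) * b)     ≡⟨ solve 3 (λ a b m → a :* ((con 1ℚ :+ m) :* b) := a :* b :+ (m :* a) :* b)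
                                                  refl a b (fromℕ (suc n)) ⟩
    a * b + (fromℕ (suc n) * a) * b    ≡⟨ cong (λ x → a * b + x * b) (fromℕ*1/ℕ (suc n)) ⟩
    a * b + 1ℚ * b                     ≡⟨ cong (a * b +_) (*-identityˡ b) ⟩
    a * b + b                          ∎
    where
    open ≡-Reasoning
    a b : ℚ
    a = 1/ℕ (suc n)
    b = 1/ℕ (suc (suc n))

  -- Telescoping: 1/(k+1)² + 1/(k+1) ≤ 1/k.
  H2+1/ℕ≤2 : ∀ n → H2 (suc n) + 1/ℕ (suc n) ≤ fromℕ 2
  H2+1/ℕ≤2 zero    = ≤-refl
  H2+1/ℕ≤2 (suc n) = begin
    h₂ + 1/ℕ (suc (suc n) ℕ.* suc (suc n)) + b  ≡⟨ cong (λ x → h₂ + x + b) (1/ℕ-* (suc (suc n)) (suc (suc n))) ⟩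
    h₂ + b * b + b                              ≡⟨ +-assoc h₂ (b * b) b ⟩
    h₂ + (b * b + b)                            ≤⟨ +-monoʳ-≤ h₂ (+-monoˡ-≤ b (*-monoʳ-≤-nonNeg b {{b≥0}} b≤a)) ⟩
    h₂ + (a * b + b)                            ≡⟨ cong (h₂ +_) (1/ℕ-split n) ⟨
    h₂ + a                                      ≤⟨ H2+1/ℕ≤2 n ⟩
    fromℕ 2                                     ∎
    where
    open ≤-Reasoning
    h₂ a b : ℚ
    h₂ = H2 (suc n)
    a = 1/ℕ (suc n)
    b = 1/ℕ (suc (suc n))
    b≥0 : NonNegative b
    b≥0 = 1/ℕ-nonNeg (suc (suc n))
    b≤a : b ≤ a
    b≤a = begin
      b          ≡⟨ +-identityˡ b ⟨
      0ℚ + b     ≤⟨ +-monoˡ-≤ b (nonNegative⁻¹ (a * b) {{nonNeg*nonNeg⇒nonNeg a {{1/ℕ-nonNeg (suc n)}} b {{b≥0}}}}) ⟩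
      a * b + b  ≡⟨ 1/ℕ-split n ⟨
      a          ∎

  H2≤2 : ∀ n → H2 n ≤ fromℕ 2
  H2≤2 zero    = ≤ᵇ⇒≤ _
  H2≤2 (suc n) = begin
    H2 (suc n)                 ≡⟨ +-identityʳ (H2 (suc n)) ⟨
    H2 (suc n) + 0ℚ            ≤⟨ +-monoʳ-≤ (H2 (suc n)) (nonNegative⁻¹ (1/ℕ (suc n)) {{1/ℕ-nonNeg (suc n)}}) ⟩
    H2 (suc n) + 1/ℕ (suc n)   ≤⟨ H2+1/ℕ≤2 n ⟩
    fromℕ 2                    ∎
    where open ≤-Reasoning

  ∣2-4H2∣≤10 : ∀ n → ∣ fromℕ 2 - fromℕ 4 * H2 n ∣ ≤ fromℕ 10
  ∣2-4H2∣≤10 n = begin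
    ∣ fromℕ 2 - fromℕ 4 * H2 n ∣  ≤⟨ ∣p-q∣≤∣p∣+∣q∣ (fromℕ 2) (fromℕ 4 * H2 n) ⟩
    fromℕ 2 + ∣ fromℕ 4 * H2 n ∣  ≡⟨ cong (fromℕ 2 +_) ∣4H2∣≡4H2 ⟩
    fromℕ 2 + fromℕ 4 * H2 n      ≤⟨ +-monoʳ-≤ (fromℕ 2) (*-monoˡ-≤-nonNeg (fromℕ 4) {{normalize-nonNeg 4 1}} (H2≤2 n)) ⟩
    fromℕ 10                      ∎
    where
    open ≤-Reasoning
    ∣4H2∣≡4H2 : ∣ fromℕ 4 * H2 n ∣ ≡ fromℕ 4 * H2 n
    ∣4H2∣≡4H2 = trans (∣p*q∣≡∣p∣*∣q∣ (fromℕ 4) (H2 n)) (cong (fromℕ 4 *_) (0≤p⇒∣p∣≡p (H2-nonNeg n)))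

  ∣Var[S]-2H∣≤10 : ∀ n → ∣ Var (suc n) (↑ S) - fromℕ 2 * H (suc n) ∣ ≤ fromℕ 10
  ∣Var[S]-2H∣≤10 n = subst (λ x → ∣ x ∣ ≤ fromℕ 10) (sym (Var[S]-2H≡2-4H2 n)) (∣2-4H2∣≤10 (suc n))

open import Data.Rational using (ℚ; _+_; _-_; _*_; ∣_∣; _≤_)
open import Data.Product using (_,_)
open Moments using (E-S; Var-S; ∣Var[S]-2H∣≤10)

theorem5p1 : ((n : ℕ) → 2 Data.Nat.≤ n →
                 (E n (λ τ → fromℕ (S τ)) ≡ fromℕ 2 * H n - fromℕ 2)
                 × (Var n (λ τ → fromℕ (S τ))
                      ≡ fromℕ 2 * (H n - H2 n) + fromℕ 2 * Cov n (λ τ → fromℕ (L τ)) (λ τ → fromℕ (R τ))))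
               × ∃ (λ (C : ℚ) → (n : ℕ) → 2 Data.Nat.≤ n →
                   ∣ Var n (λ τ → fromℕ (S τ)) - fromℕ 2 * H n ∣ ≤ C)
theorem5p1 =
  (λ { Data.Nat.zero () ; (Data.Nat.suc n) _ → E-S n , Var-S n }) ,
  fromℕ 10 , λ { Data.Nat.zero () ; (Data.Nat.suc n) _ → ∣Var[S]-2H∣≤10 n }
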